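{- Let $C_n$ be the cycle on $n\ge3$ vertices. Then $C_n$ is $1$-elementary if and only if $n=3k$ for some positive integer $k$.
   Context: All graphs are finite and simple. $\mu(G,x)=\sum_{r\ge0}(-1)^r p(G,r)x^{n-2r}$ is the matching polynomial of a graph $G$ on $n$ vertices, where $p(G,r)$ is the number of $r$-matchings ($p(G,0)=1$); $\mathrm{mult}(\theta,G)$ is the multiplicity of $\theta$ as a root of $\mu(G,x)$. $G\setminus v$ denotes deletion of vertex $v$. A vertex $u$ of $H$ is $\theta$-essential if $\mathrm{mult}(\theta,H\setminus u)=\mathrm{mult}(\theta,H)-1$, $\theta$-positive if $\mathrm{mult}(\theta,H\setminus u)=\mathrm{mult}(\theta,H)+1$, and $\theta$-special if it is not $\theta$-essential but is adjacent to a $\theta$-essential vertex. $P_\theta(H)$ is the set of $\theta$-positive vertices of $H$ that are not $\theta$-special. $G$ is $\theta$-super positive if $\mathrm{mult}(\theta,G)=0$ and every vertex is $\theta$-positive; $G$ is $\theta$-elementary if it is $\theta$-super positive and $P_\theta(G\setminus v)=\varnothing$ for all $v\in V(G)$. -}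

module Defs where

open import Data.Bool using (Bool; true; false; _∧_; _∨_; if_then_else_; not)
open import Data.Nat as ℕ using (ℕ; zero; suc; _≡ᵇ_; _<ᵇ_; _%_; _/_)
open import Data.Integer as ℤ using (ℤ; +_; -_; _+_; _*_; ∣_∣)
open import Data.Fin using (Fin; toℕ; punchIn)
open import Data.List using (List; []; _∷_; length; filter; map; concatMap; upTo; allFin)
open import Data.Product using (Σ; _×_; _,_; ∃)
open import Relation.Binary.PropositionalEquality using (_≡_)
open import Relation.Nullary using (¬_)
open import Data.Bool.Properties using (T?)
open import Data.Unit using (⊤)
open import Data.Bool using (T)

-- Graphs: a graph on n vertices is a (symmetric, loopless) adjacency
-- function on Fin n.  Only unordered pairs i < j are ever consulted.

Graph : ℕ → Set
Graph n = Fin n → Fin n → Bool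

_∖_ : ∀ {n} → Graph (suc n) → Fin (suc n) → Graph n
(G ∖ v) i j = G (punchIn v i) (punchIn v j)

Adj : ∀ {n} → Graph n → Fin n → Fin n → Set
Adj G i j = T (G i j)

cycleAdjℕ : ℕ → ℕ → ℕ → Bool
cycleAdjℕ n a b = (suc a ≡ᵇ b) ∨ (suc b ≡ᵇ a)
                ∨ ((a ≡ᵇ 0) ∧ (suc b ≡ᵇ n)) ∨ ((b ≡ᵇ 0) ∧ (suc a ≡ᵇ n))

cycle : (n : ℕ) → Graph n
cycle n i j = cycleAdjℕ n (toℕ i) (toℕ j)

Edge : ℕ → Set
Edge n = Fin n × Fin n

edges : ∀ {n} → Graph n → List (Edge n)
edges {n} G = concatMap (λ i → concatMap (λ j →
                if (toℕ i <ᵇ toℕ j) ∧ G i j then (i , j) ∷ [] else [])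
                (allFin n)) (allFin n)

-- all sublists (= all subsets of the list of distinct edges)
subsets : ∀ {A : Set} → List A → List (List A)
subsets [] = [] ∷ []
subsets (x ∷ xs) = let s = subsets xs in s Data.List.++ map (x ∷_) s

disjointE : ∀ {n} → Edge n → Edge n → Bool
disjointE (a , b) (c , d) =
  not ((toℕ a ≡ᵇ toℕ c) ∨ (toℕ a ≡ᵇ toℕ d) ∨ (toℕ b ≡ᵇ toℕ c) ∨ (toℕ b ≡ᵇ toℕ d))

allB : ∀ {A : Set} → (A → Bool) → List A → Bool
allB f [] = true
allB f (x ∷ xs) = f x ∧ allB f xs

isMatching : ∀ {n} → List (Edge n) → Bool
isMatching [] = true
isMatching (e ∷ es) = allB (disjointE e) es ∧ isMatching es

p : ∀ {n} → Graph n → ℕ → ℕ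
p G r = length (filter (λ M → T? ((length M ≡ᵇ r) ∧ isMatching M)) (subsets (edges G)))

-- Matching polynomial  μ(G,x) = Σ_r (-1)^r p(G,r) x^(n-2r),
-- as its coefficient list from highest degree (x^n) down to x^0.

sgn : ℕ → ℤ
sgn zero = + 1
sgn (suc r) = - sgn r

-- coefficient of x^(n-i)
μcoeff : ∀ {n} → Graph n → ℕ → ℤ
μcoeff G i = if (i % 2) ≡ᵇ 0 then sgn (i / 2) * (+ (p G (i / 2))) else + 0

μ : ∀ {n} → Graph n → List ℤ
μ {n} G = map (μcoeff G) (upTo (suc n))

-- Multiplicity of θ as a root: repeated synthetic division by (x - θ).
-- synth θ a = (quotient, remainder) for coefficient lists high-to-low.

synth : ℤ → List ℤ → List ℤ × ℤ
synth θ [] = [] , + 0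
synth θ (a ∷ as) = go a as
  where
  go : ℤ → List ℤ → List ℤ × ℤ
  go acc [] = [] , acc
  go acc (b ∷ bs) with go (b + θ * acc) bs
  ... | q , r = acc ∷ q , r

multAux : ℕ → ℤ → List ℤ → ℕ
multAux zero θ f = zero
multAux (suc k) θ f with synth θ f
... | q , r = if ∣ r ∣ ≡ᵇ 0 then suc (multAux k θ q) else zero

-- μ(G,x) is monic of degree n, so at most n factors (x-θ) divide it:
-- fuel n is enough.
mult : ∀ {n} → ℤ → Graph n → ℕ
mult {n} θ G = multAux n θ (μ G)

Essential : ∀ {n} → ℤ → Graph (suc n) → Fin (suc n) → Set
Essential θ H u = suc (mult θ (H ∖ u)) ≡ mult θ H

Positive : ∀ {n} → ℤ → Graph (suc n) → Fin (suc n) → Set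
Positive θ H u = mult θ (H ∖ u) ≡ suc (mult θ H)

Special : ∀ {n} → ℤ → Graph (suc n) → Fin (suc n) → Set
Special θ H u = ¬ Essential θ H u × ∃ λ w → Adj H u w × Essential θ H w

PEmpty : ∀ {n} → ℤ → Graph n → Set
PEmpty {zero} θ H = ⊤
PEmpty {suc n} θ H = ¬ (∃ λ u → Positive θ H u × ¬ Special θ H u)

SuperPositive : ∀ {n} → ℤ → Graph n → Set
SuperPositive {zero} θ G = mult θ G ≡ 0
SuperPositive {suc n} θ G = mult θ G ≡ 0 × (∀ v → Positive θ G v)

Elementary : ∀ {n} → ℤ → Graph n → Set
Elementary {zero} θ G = SuperPositive θ G
Elementary {suc n} θ G = SuperPositive θ G × (∀ v → PEmpty θ (G ∖ v))

module Submission where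

-- Evaluating the matching polynomial and its derivative at 1 turns both into signed sums over
-- matchings: mult(1, G) is 0 when Σ_M (-1)^|M| ≠ 0, and 1 when this vanishes but Σ_M (-1)^|M| (n - 2|M|)
-- does not. For the path P_k these sums are σ k and k σ k - 2 τ k, where σ (k + 2) = σ (k + 1) - σ k, so
-- σ k = 0 exactly when k ≡ 2 (mod 3). Deleting a vertex of C_n leaves P_{n-1}, deleting a second one leaves
-- P_c ∪ P_d with c + d = n - 2, and μ(C_n, 1) = σ n - σ (n - 2). If C_n is 1-elementary, a vertex of C_n
-- is positive, so σ (n - 1) = 0 and 3 ∣ n. If n = 3k, then mult(1, C_n) = 0, mult(1, C_n ∖ v) = 1, and a
-- positive vertex of P_{n-1} cuts it into P_c and P_d with c ≡ d ≡ 2 (mod 3); its neighbour on the P_c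
-- side cuts it into P_{c-1} and P_{d+1}, both with nonzero σ, so it is essential and the vertex is special.

open import Defs
open import Data.Bool using (Bool; true; false; _∧_; _∨_; if_then_else_; not; T)
import Data.Bool.Properties as Bool
open import Data.Bool.Properties using (T?; T-∧; ∧-comm; ∨-comm)
open import Data.Empty using (⊥; ⊥-elim)
open import Data.Fin using (Fin; toℕ; fromℕ<; punchIn; punchOut) renaming (zero to fzero; suc to fsuc)
import Data.Fin.Properties as Fin
open import Data.Integer using (ℤ; +_; -_; _+_; _*_; _-_; ∣_∣)
import Data.Integer.Properties as ℤP
open import Data.Integer.Tactic.RingSolver using (solve-∀)
open import Data.List
  using (List; []; _∷_; _++_; map; length; lookup; concatMap; allFin; applyUpTo; filterᵇ; initLast; _∷ʳ′_)
import Data.List.Properties as List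
open import Data.List.Membership.Propositional using (_∈_; _∉_; find; lose)
open import Data.List.Membership.Propositional.Properties
  using (∈-++⁻; ∈-++⁺ˡ; ∈-++⁺ʳ; ∈-∃++; ∈-map⁺; ∈-map⁻; ∈-filter⁺; ∈-filter⁻; ∈-concatMap⁺; ∈-concatMap⁻
        ; ∈-allFin; ∈-lookup)
open import Data.List.Membership.Propositional.Properties.WithK using (unique∧set⇒bag)
open import Data.List.Relation.Binary.BagAndSetEquality using (∼bag⇒↭)
open import Data.List.Relation.Binary.Permutation.Propositional as ↭ using (_↭_)
import Data.List.Relation.Binary.Permutation.Propositional.Properties as ↭
open import Data.List.Relation.Unary.All as All using (All; []; _∷_)
import Data.List.Relation.Unary.All.Properties as All
open import Data.List.Relation.Unary.All.Properties using (¬Any⇒All¬)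
import Data.List.Relation.Unary.AllPairs as AllPairs
import Data.List.Relation.Unary.AllPairs.Properties as AllPairs
open import Data.List.Relation.Unary.Any using (here; there)
open import Data.List.Relation.Unary.Unique.Propositional using (Unique)
import Data.List.Relation.Unary.Unique.Propositional.Properties as Unique
open import Data.List.Relation.Unary.Unique.Propositional.Properties using (Unique[x∷xs]⇒x∉xs)
open import Data.Nat as ℕ using (ℕ; zero; suc; _≡ᵇ_; _<ᵇ_; _≤_; _<_; z≤n; s≤s; _%_; _/_; _∸_; pred; _≟_)
import Data.Nat.DivMod as ℕ
import Data.Nat.Properties as ℕP
import Data.Nat.Tactic.RingSolver as ℕ-Solver
open import Data.Product using (_×_; _,_; ∃; ∃₂; proj₁; proj₂)
open import Data.Sum using (_⊎_; inj₁; inj₂)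
open import Data.Unit using (tt)
open import Function using (_∘_)
open import Function.Bundles using (Equivalence; _⇔_; mk⇔)
open import Relation.Binary using (tri<; tri≈; tri>)
open import Relation.Binary.PropositionalEquality
open import Relation.Nullary using (¬_; yes; no)

sumℤ : List ℤ → ℤ
sumℤ [] = + 0
sumℤ (x ∷ xs) = x + sumℤ xs

sumℤ-++ : ∀ xs ys → sumℤ (xs ++ ys) ≡ sumℤ xs + sumℤ ys
sumℤ-++ [] ys = sym (ℤP.+-identityˡ _)
sumℤ-++ (x ∷ xs) ys rewrite sumℤ-++ xs ys = sym (ℤP.+-assoc x (sumℤ xs) (sumℤ ys))

sumℤ-cong : ∀ {A : Set} {f g : A → ℤ} → (∀ a → f a ≡ g a) → ∀ xs → sumℤ (map f xs) ≡ sumℤ (map g xs)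
sumℤ-cong f≗g [] = refl
sumℤ-cong f≗g (x ∷ xs) = cong₂ _+_ (f≗g x) (sumℤ-cong f≗g xs)

sumℤ-cong∈ : ∀ {A : Set} {f g : A → ℤ} xs → (∀ {x} → x ∈ xs → f x ≡ g x) → sumℤ (map f xs) ≡ sumℤ (map g xs)
sumℤ-cong∈ [] f≗g = refl
sumℤ-cong∈ (x ∷ xs) f≗g = cong₂ _+_ (f≗g (here refl)) (sumℤ-cong∈ xs (f≗g ∘ there))

sumℤ-zero : ∀ {A : Set} (xs : List A) → sumℤ (map (λ _ → + 0) xs) ≡ + 0
sumℤ-zero [] = refl
sumℤ-zero (x ∷ xs) = trans (ℤP.+-identityˡ _) (sumℤ-zero xs)

sumℤ-*ˡ : ∀ {A : Set} a (f : A → ℤ) xs → sumℤ (map (λ x → a * f x) xs) ≡ a * sumℤ (map f xs)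
sumℤ-*ˡ a f [] = sym (ℤP.*-zeroʳ a)
sumℤ-*ˡ a f (x ∷ xs) rewrite sumℤ-*ˡ a f xs = sym (ℤP.*-distribˡ-+ a (f x) (sumℤ (map f xs)))

ΣSub : ∀ {A : Set} → (List A → ℤ) → List A → ℤ
ΣSub Φ L = sumℤ (map Φ (subsets L))

ΣSub-∷ : ∀ {A : Set} (Φ : List A → ℤ) x L → ΣSub Φ (x ∷ L) ≡ ΣSub Φ L + ΣSub (Φ ∘ (x ∷_)) L
ΣSub-∷ Φ x L = begin
  sumℤ (map Φ (subsets L ++ map (x ∷_) (subsets L)))
    ≡⟨ cong sumℤ (List.map-++ Φ (subsets L) _) ⟩
  sumℤ (map Φ (subsets L) ++ map Φ (map (x ∷_) (subsets L)))
    ≡⟨ sumℤ-++ (map Φ (subsets L)) _ ⟩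
  ΣSub Φ L + sumℤ (map Φ (map (x ∷_) (subsets L)))
    ≡⟨ cong (λ s → ΣSub Φ L + sumℤ s) (sym (List.map-∘ (subsets L))) ⟩
  ΣSub Φ L + ΣSub (Φ ∘ (x ∷_)) L ∎
  where open ≡-Reasoning

ΣSub-cong : ∀ {A : Set} {Φ Ψ : List A → ℤ} → (∀ M → Φ M ≡ Ψ M) → ∀ L → ΣSub Φ L ≡ ΣSub Ψ L
ΣSub-cong Φ≗Ψ L = sumℤ-cong Φ≗Ψ (subsets L)

ΣSub-zero : ∀ {A : Set} (L : List A) → ΣSub (λ _ → + 0) L ≡ + 0
ΣSub-zero L = sumℤ-zero (subsets L)

Respects↭ : ∀ {A : Set} → (List A → ℤ) → Set
Respects↭ Φ = ∀ {l l'} → l ↭ l' → Φ l ≡ Φ l'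

ΣSub-↭ : ∀ {A : Set} {L L' : List A} → L ↭ L' → ∀ Φ → Respects↭ Φ → ΣSub Φ L ≡ ΣSub Φ L'
ΣSub-↭ ↭.refl Φ resp = refl
ΣSub-↭ {L = x ∷ xs} {L' = .x ∷ ys} (↭.prep x p) Φ resp = begin
  ΣSub Φ (x ∷ xs) ≡⟨ ΣSub-∷ Φ x xs ⟩
  ΣSub Φ xs + ΣSub (Φ ∘ (x ∷_)) xs
    ≡⟨ cong₂ _+_ (ΣSub-↭ p Φ resp) (ΣSub-↭ p (Φ ∘ (x ∷_)) (resp ∘ ↭.prep x)) ⟩
  ΣSub Φ ys + ΣSub (Φ ∘ (x ∷_)) ys ≡⟨ sym (ΣSub-∷ Φ x ys) ⟩
  ΣSub Φ (x ∷ ys) ∎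
  where open ≡-Reasoning
ΣSub-↭ {L = x ∷ y ∷ xs} {L' = .y ∷ .x ∷ ys} (↭.swap x y p) Φ resp = begin
  ΣSub Φ (x ∷ y ∷ xs) ≡⟨ ΣSub-∷ Φ x (y ∷ xs) ⟩
  ΣSub Φ (y ∷ xs) + ΣSub Φx (y ∷ xs) ≡⟨ cong₂ _+_ (ΣSub-∷ Φ y xs) (ΣSub-∷ Φx y xs) ⟩
  (ΣSub Φ xs + ΣSub Φy xs) + (ΣSub Φx xs + ΣSub Φxy xs)
    ≡⟨ cong (λ s → (ΣSub Φ xs + ΣSub Φy xs) + (ΣSub Φx xs + s))
         (ΣSub-cong (λ M → resp (↭.swap x y ↭.refl)) xs) ⟩
  (ΣSub Φ xs + ΣSub Φy xs) + (ΣSub Φx xs + ΣSub Φyx xs)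
    ≡⟨ middle-swap (ΣSub Φ xs) (ΣSub Φy xs) (ΣSub Φx xs) (ΣSub Φyx xs) ⟩
  (ΣSub Φ xs + ΣSub Φx xs) + (ΣSub Φy xs + ΣSub Φyx xs)
    ≡⟨ cong₂ _+_ (cong₂ _+_ (ΣSub-↭ p Φ resp) (ΣSub-↭ p Φx (resp ∘ ↭.prep x)))
                 (cong₂ _+_ (ΣSub-↭ p Φy (resp ∘ ↭.prep y))
                            (ΣSub-↭ p Φyx (resp ∘ ↭.prep y ∘ ↭.prep x))) ⟩
  (ΣSub Φ ys + ΣSub Φx ys) + (ΣSub Φy ys + ΣSub Φyx ys)
    ≡⟨ cong₂ _+_ (sym (ΣSub-∷ Φ x ys)) (sym (ΣSub-∷ Φy x ys)) ⟩
  ΣSub Φ (x ∷ ys) + ΣSub Φy (x ∷ ys) ≡⟨ sym (ΣSub-∷ Φ y (x ∷ ys)) ⟩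
  ΣSub Φ (y ∷ x ∷ ys) ∎
  where
  open ≡-Reasoning
  Φx = Φ ∘ (x ∷_)
  Φy = Φ ∘ (y ∷_)
  Φxy = Φ ∘ (λ M → x ∷ y ∷ M)
  Φyx = Φ ∘ (λ M → y ∷ x ∷ M)
  middle-swap : ∀ a b c d → (a + b) + (c + d) ≡ (a + c) + (b + d)
  middle-swap = solve-∀
ΣSub-↭ (↭.trans p q) Φ resp = trans (ΣSub-↭ p Φ resp) (ΣSub-↭ q Φ resp)

ΣSub-filter : ∀ {A : Set} (f : A → Bool) (Ψ : List A → ℤ) L →
  ΣSub (λ M → if allB f M then Ψ M else + 0) L ≡ ΣSub Ψ (filterᵇ f L)
ΣSub-filter f Ψ [] = refl
ΣSub-filter f Ψ (x ∷ L) with f x in fx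
... | true = begin
  ΣSub Ψᶠ (x ∷ L) ≡⟨ ΣSub-∷ Ψᶠ x L ⟩
  ΣSub Ψᶠ L + ΣSub (Ψᶠ ∘ (x ∷_)) L
    ≡⟨ cong (_+_ (ΣSub Ψᶠ L)) (ΣSub-cong (λ M → cong (λ b → if b ∧ allB f M then Ψ (x ∷ M) else + 0) fx) L) ⟩
  ΣSub Ψᶠ L + ΣSub (λ M → if allB f M then Ψ (x ∷ M) else + 0) L
    ≡⟨ cong₂ _+_ (ΣSub-filter f Ψ L) (ΣSub-filter f (Ψ ∘ (x ∷_)) L) ⟩
  ΣSub Ψ (filterᵇ f L) + ΣSub (Ψ ∘ (x ∷_)) (filterᵇ f L) ≡⟨ sym (ΣSub-∷ Ψ x (filterᵇ f L)) ⟩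
  ΣSub Ψ (x ∷ filterᵇ f L) ∎
  where
  open ≡-Reasoning
  Ψᶠ = λ M → if allB f M then Ψ M else + 0
... | false = begin
  ΣSub Ψᶠ (x ∷ L) ≡⟨ ΣSub-∷ Ψᶠ x L ⟩
  ΣSub Ψᶠ L + ΣSub (Ψᶠ ∘ (x ∷_)) L
    ≡⟨ cong (_+_ (ΣSub Ψᶠ L)) (ΣSub-cong (λ M → cong (λ b → if b ∧ allB f M then Ψ (x ∷ M) else + 0) fx) L) ⟩
  ΣSub Ψᶠ L + ΣSub (λ _ → + 0) L ≡⟨ cong (_+_ (ΣSub Ψᶠ L)) (ΣSub-zero L) ⟩
  ΣSub Ψᶠ L + + 0 ≡⟨ ℤP.+-identityʳ _ ⟩
  ΣSub Ψᶠ L ≡⟨ ΣSub-filter f Ψ L ⟩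
  ΣSub Ψ (filterᵇ f L) ∎
  where
  open ≡-Reasoning
  Ψᶠ = λ M → if allB f M then Ψ M else + 0

Pair : Set
Pair = ℕ × ℕ

disjointℕ : Pair → Pair → Bool
disjointℕ (a , b) (c , d) = not ((a ≡ᵇ c) ∨ (a ≡ᵇ d) ∨ (b ≡ᵇ c) ∨ (b ≡ᵇ d))

isMatchingℕ : List Pair → Bool
isMatchingℕ [] = true
isMatchingℕ (e ∷ es) = allB (disjointℕ e) es ∧ isMatchingℕ es

≡ᵇ-sym : ∀ a b → (a ≡ᵇ b) ≡ (b ≡ᵇ a)
≡ᵇ-sym zero zero = refl
≡ᵇ-sym zero (suc b) = refl
≡ᵇ-sym (suc a) zero = refl
≡ᵇ-sym (suc a) (suc b) = ≡ᵇ-sym a b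

disjointℕ-sym : ∀ x y → disjointℕ x y ≡ disjointℕ y x
disjointℕ-sym (a , b) (c , d)
  rewrite ≡ᵇ-sym a c | ≡ᵇ-sym a d | ≡ᵇ-sym b c | ≡ᵇ-sym b d
  = cong not (∨-swap-middle (c ≡ᵇ a) (d ≡ᵇ a) (c ≡ᵇ b) (d ≡ᵇ b))
  where
  ∨-swap-middle : ∀ p q r s → (p ∨ q ∨ r ∨ s) ≡ (p ∨ r ∨ q ∨ s)
  ∨-swap-middle true q r s = refl
  ∨-swap-middle false true true s = refl
  ∨-swap-middle false true false s = refl
  ∨-swap-middle false false r s = refl

∧-swapˡ : ∀ p q r → (p ∧ (q ∧ r)) ≡ (q ∧ (p ∧ r))
∧-swapˡ true q r = refl
∧-swapˡ false true r = refl
∧-swapˡ false false r = refl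

allB-↭ : ∀ {A : Set} (f : A → Bool) {l l'} → l ↭ l' → allB f l ≡ allB f l'
allB-↭ f ↭.refl = refl
allB-↭ f (↭.prep x p) = cong (f x ∧_) (allB-↭ f p)
allB-↭ f (↭.swap x y p) rewrite allB-↭ f p = ∧-swapˡ (f x) (f y) _
allB-↭ f (↭.trans p q) = trans (allB-↭ f p) (allB-↭ f q)

isMatchingℕ-↭ : ∀ {l l'} → l ↭ l' → isMatchingℕ l ≡ isMatchingℕ l'
isMatchingℕ-↭ ↭.refl = refl
isMatchingℕ-↭ (↭.prep x p) = cong₂ _∧_ (allB-↭ (disjointℕ x) p) (isMatchingℕ-↭ p)
isMatchingℕ-↭ {x ∷ y ∷ xs} {.y ∷ .x ∷ ys} (↭.swap x y p)
  rewrite allB-↭ (disjointℕ x) p | allB-↭ (disjointℕ y) p | isMatchingℕ-↭ p | disjointℕ-sym x y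
  = ∧-interchange (disjointℕ y x) (allB (disjointℕ x) ys) (allB (disjointℕ y) ys) (isMatchingℕ ys)
  where
  ∧-interchange : ∀ p q r s → ((p ∧ q) ∧ (r ∧ s)) ≡ ((p ∧ r) ∧ (q ∧ s))
  ∧-interchange true q r s = ∧-swapˡ q r s
  ∧-interchange false q r s = refl
isMatchingℕ-↭ (↭.trans p q) = trans (isMatchingℕ-↭ p) (isMatchingℕ-↭ q)

-- matchingSum F L = Σ F |M| over the matchings M ⊆ L (L a duplicate-free edge list).

matchingWeight : (ℕ → ℤ) → List Pair → ℤ
matchingWeight F M = if isMatchingℕ M then F (length M) else + 0

matchingSum : (ℕ → ℤ) → List Pair → ℤ
matchingSum F = ΣSub (matchingWeight F)

matchingSum-↭ : ∀ F {L L'} → L ↭ L' → matchingSum F L ≡ matchingSum F L'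
matchingSum-↭ F p = ΣSub-↭ p (matchingWeight F) weight-↭
  where
  weight-↭ : Respects↭ (matchingWeight F)
  weight-↭ q rewrite isMatchingℕ-↭ q | ↭.↭-length q = refl

matchingSum-cong : ∀ {F F'} → (∀ r → F r ≡ F' r) → ∀ L → matchingSum F L ≡ matchingSum F' L
matchingSum-cong {F} {F'} F≗F' = ΣSub-cong weight≗
  where
  weight≗ : ∀ M → matchingWeight F M ≡ matchingWeight F' M
  weight≗ M with isMatchingℕ M
  ... | true = F≗F' (length M)
  ... | false = refl

matchingSum-*ˡ : ∀ a F → ∀ L → matchingSum (λ r → a * F r) L ≡ a * matchingSum F L
matchingSum-*ˡ a F L = trans (ΣSub-cong weight≗ L) (sumℤ-*ˡ a (matchingWeight F) (subsets L))
  where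
  weight≗ : ∀ M → matchingWeight (λ r → a * F r) M ≡ a * matchingWeight F M
  weight≗ M with isMatchingℕ M
  ... | true = refl
  ... | false = sym (ℤP.*-zeroʳ a)

-- Either the first edge is unused, or it is used and the rest of the matching avoids it.
matchingSum-∷ : ∀ F e L → matchingSum F (e ∷ L) ≡ matchingSum F L + matchingSum (F ∘ suc) (filterᵇ (disjointℕ e) L)
matchingSum-∷ F e L = begin
  matchingSum F (e ∷ L) ≡⟨ ΣSub-∷ (matchingWeight F) e L ⟩
  matchingSum F L + ΣSub (matchingWeight F ∘ (e ∷_)) L
    ≡⟨ cong (_+_ (matchingSum F L)) (ΣSub-cong weight-∷ L) ⟩
  matchingSum F L + ΣSub (λ M → if allB (disjointℕ e) M then matchingWeight (F ∘ suc) M else + 0) L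
    ≡⟨ cong (_+_ (matchingSum F L)) (ΣSub-filter (disjointℕ e) (matchingWeight (F ∘ suc)) L) ⟩
  matchingSum F L + matchingSum (F ∘ suc) (filterᵇ (disjointℕ e) L) ∎
  where
  open ≡-Reasoning
  weight-∷ : ∀ M → matchingWeight F (e ∷ M) ≡ (if allB (disjointℕ e) M then matchingWeight (F ∘ suc) M else + 0)
  weight-∷ M with allB (disjointℕ e) M
  ... | true = refl
  ... | false = refl

-- Paths

sortedPair : ℕ → ℕ → Pair
sortedPair a b = if a <ᵇ b then (a , b) else (b , a)

pathEdges : List ℕ → List Pair
pathEdges [] = []
pathEdges (a ∷ []) = []
pathEdges (a ∷ b ∷ r) = sortedPair a b ∷ pathEdges (b ∷ r)

avoids : ℕ → Pair → Bool
avoids w (c , d) = not ((w ≡ᵇ c) ∨ (w ≡ᵇ d))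

≡ᵇ-refl : ∀ a → (a ≡ᵇ a) ≡ true
≡ᵇ-refl zero = refl
≡ᵇ-refl (suc a) = ≡ᵇ-refl a

≢⇒≡ᵇ-false : ∀ a b → a ≢ b → (a ≡ᵇ b) ≡ false
≢⇒≡ᵇ-false zero zero a≢b = ⊥-elim (a≢b refl)
≢⇒≡ᵇ-false zero (suc b) a≢b = refl
≢⇒≡ᵇ-false (suc a) zero a≢b = refl
≢⇒≡ᵇ-false (suc a) (suc b) a≢b = ≢⇒≡ᵇ-false a b (a≢b ∘ cong suc)

avoids-sortedPair : ∀ w a b → avoids w (sortedPair a b) ≡ not ((w ≡ᵇ a) ∨ (w ≡ᵇ b))
avoids-sortedPair w a b with a <ᵇ b
... | true = refl
... | false = cong not (∨-comm (w ≡ᵇ b) (w ≡ᵇ a))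

not-∨-split : ∀ p q r s → not (p ∨ q ∨ r ∨ s) ≡ (not (p ∨ q) ∧ not (r ∨ s))
not-∨-split true q r s = refl
not-∨-split false true r s = refl
not-∨-split false false r s = refl

disjointℕ-sortedPair : ∀ a b e → disjointℕ (sortedPair a b) e ≡ (avoids a e ∧ avoids b e)
disjointℕ-sortedPair a b (c , d) with a <ᵇ b
... | true = not-∨-split (a ≡ᵇ c) (a ≡ᵇ d) (b ≡ᵇ c) (b ≡ᵇ d)
... | false = trans (not-∨-split (b ≡ᵇ c) (b ≡ᵇ d) (a ≡ᵇ c) (a ≡ᵇ d))
                    (∧-comm (not ((b ≡ᵇ c) ∨ (b ≡ᵇ d))) (not ((a ≡ᵇ c) ∨ (a ≡ᵇ d))))

avoids-sortedPair-left : ∀ a b → avoids a (sortedPair a b) ≡ false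
avoids-sortedPair-left a b rewrite avoids-sortedPair a a b | ≡ᵇ-refl a = refl

avoids-sortedPair-right : ∀ a b → avoids b (sortedPair a b) ≡ false
avoids-sortedPair-right a b rewrite avoids-sortedPair b a b | ≡ᵇ-refl b | ∨-comm (b ≡ᵇ a) true = refl

avoids-sortedPair-≢ : ∀ {w a b} → w ≢ a → w ≢ b → T (avoids w (sortedPair a b))
avoids-sortedPair-≢ {w} {a} {b} w≢a w≢b
  rewrite avoids-sortedPair w a b | ≢⇒≡ᵇ-false w a w≢a | ≢⇒≡ᵇ-false w b w≢b = tt

pathEdges-avoids : ∀ {w} xs → w ∉ xs → All (T ∘ avoids w) (pathEdges xs)
pathEdges-avoids [] w∉ = []
pathEdges-avoids (a ∷ []) w∉ = []
pathEdges-avoids (a ∷ b ∷ r) w∉ =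
  avoids-sortedPair-≢ (w∉ ∘ here) (w∉ ∘ there ∘ here) ∷ pathEdges-avoids (b ∷ r) (w∉ ∘ there)

filter-avoids-pathEdges : ∀ {w} xs → w ∉ xs → filterᵇ (avoids w) (pathEdges xs) ≡ pathEdges xs
filter-avoids-pathEdges {w} xs w∉ = List.filter-all (T? ∘ avoids w) (pathEdges-avoids xs w∉)

filter-avoids-pathEdges-split : ∀ w C D →
  filterᵇ (avoids w) (pathEdges (C ++ w ∷ D)) ≡ filterᵇ (avoids w) (pathEdges C) ++ filterᵇ (avoids w) (pathEdges D)
filter-avoids-pathEdges-split w [] [] = refl
filter-avoids-pathEdges-split w [] (d ∷ D) rewrite avoids-sortedPair-left w d = refl
filter-avoids-pathEdges-split w (c ∷ []) D rewrite avoids-sortedPair-right c w = filter-avoids-pathEdges-split w [] D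
filter-avoids-pathEdges-split w (c ∷ c' ∷ C) D
  with ih ← filter-avoids-pathEdges-split w (c' ∷ C) D | avoids w (sortedPair c c')
... | true = cong (sortedPair c c' ∷_) ih
... | false = ih

filterᵇ-∧ : ∀ {A : Set} (f g : A → Bool) L → filterᵇ (λ a → f a ∧ g a) L ≡ filterᵇ g (filterᵇ f L)
filterᵇ-∧ f g [] = refl
filterᵇ-∧ f g (x ∷ L) with f x
... | false = filterᵇ-∧ f g L
... | true with g x
...   | true = cong (x ∷_) (filterᵇ-∧ f g L)
...   | false = filterᵇ-∧ f g L

filterᵇ-cong : ∀ {A : Set} {f g : A → Bool} → (∀ a → f a ≡ g a) → ∀ L → filterᵇ f L ≡ filterᵇ g L
filterᵇ-cong f≗g [] = refl
filterᵇ-cong {g = g} f≗g (x ∷ L) rewrite f≗g x with g x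
... | true = cong (x ∷_) (filterᵇ-cong f≗g L)
... | false = filterᵇ-cong f≗g L

filter-disjoint-first-edge : ∀ x y r → x ∉ r → y ∉ r →
  filterᵇ (disjointℕ (sortedPair x y)) (pathEdges (y ∷ r)) ≡ pathEdges r
filter-disjoint-first-edge x y [] x∉ y∉ = refl
filter-disjoint-first-edge x y (z ∷ r) x∉ y∉
  rewrite disjointℕ-sortedPair x y (sortedPair y z) | avoids-sortedPair-left y z | ∧-comm (avoids x (sortedPair y z)) false
  = begin
    filterᵇ (disjointℕ (sortedPair x y)) (pathEdges (z ∷ r))
      ≡⟨ filterᵇ-cong (disjointℕ-sortedPair x y) (pathEdges (z ∷ r)) ⟩
    filterᵇ (λ e → avoids x e ∧ avoids y e) (pathEdges (z ∷ r))
      ≡⟨ filterᵇ-∧ (avoids x) (avoids y) (pathEdges (z ∷ r)) ⟩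
    filterᵇ (avoids y) (filterᵇ (avoids x) (pathEdges (z ∷ r)))
      ≡⟨ cong (filterᵇ (avoids y)) (filter-avoids-pathEdges (z ∷ r) x∉) ⟩
    filterᵇ (avoids y) (pathEdges (z ∷ r)) ≡⟨ filter-avoids-pathEdges (z ∷ r) y∉ ⟩
    pathEdges (z ∷ r) ∎
  where open ≡-Reasoning

pathEdges-++ : ∀ xs z ys → pathEdges (xs ++ z ∷ ys) ≡ pathEdges (xs ++ z ∷ []) ++ pathEdges (z ∷ ys)
pathEdges-++ [] z ys = refl
pathEdges-++ (x ∷ []) z ys = refl
pathEdges-++ (x ∷ x' ∷ xs) z ys = cong (sortedPair x x' ∷_) (pathEdges-++ (x' ∷ xs) z ys)

-- σ k = μ(P_k, 1) and τ k = Σ_M (-1)^|M| |M| over the matchings M of the path P_k on k vertices,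
-- as follows from the deletion recurrence μ(P_{k+2}) = x μ(P_{k+1}) - μ(P_k).

σ : ℕ → ℤ
σ 0 = + 1
σ 1 = + 1
σ (suc (suc k)) = σ (suc k) - σ k

τ : ℕ → ℤ
τ 0 = + 0
τ 1 = + 0
τ (suc (suc k)) = τ (suc k) - τ k - σ k

signedAffine : ℤ → ℤ → ℕ → ℤ
signedAffine a b r = sgn r * (a + b * + r)

matchingSum-path-signedAffine : ∀ xs → Unique xs → ∀ a b →
  matchingSum (signedAffine a b) (pathEdges xs) ≡ a * σ (length xs) + b * τ (length xs)
matchingSum-path-signedAffine [] u a b = base a b
  where
  base : ∀ a b → + 1 * (a + b * + 0) + + 0 ≡ a * + 1 + b * + 0
  base = solve-∀
matchingSum-path-signedAffine (x ∷ []) u a b = matchingSum-path-signedAffine [] AllPairs.[] a b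
matchingSum-path-signedAffine (x ∷ y ∷ r) u@(_ AllPairs.∷ u') a b = begin
  matchingSum F (sortedPair x y ∷ pathEdges (y ∷ r))
    ≡⟨ matchingSum-∷ F (sortedPair x y) (pathEdges (y ∷ r)) ⟩
  matchingSum F (pathEdges (y ∷ r)) + matchingSum (F ∘ suc) (filterᵇ (disjointℕ (sortedPair x y)) (pathEdges (y ∷ r)))
    ≡⟨ cong (λ L → matchingSum F (pathEdges (y ∷ r)) + matchingSum (F ∘ suc) L)
         (filter-disjoint-first-edge x y r (Unique[x∷xs]⇒x∉xs u ∘ there) (Unique[x∷xs]⇒x∉xs u')) ⟩
  matchingSum F (pathEdges (y ∷ r)) + matchingSum (F ∘ suc) (pathEdges r)
    ≡⟨ cong (_+_ (matchingSum F (pathEdges (y ∷ r)))) (matchingSum-cong shift (pathEdges r)) ⟩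
  matchingSum F (pathEdges (y ∷ r)) + matchingSum (signedAffine (- (a + b)) (- b)) (pathEdges r)
    ≡⟨ cong₂ _+_ (matchingSum-path-signedAffine (y ∷ r) u' a b)
                 (matchingSum-path-signedAffine r (AllPairs.tail u') (- (a + b)) (- b)) ⟩
  (a * σ (suc k) + b * τ (suc k)) + (- (a + b) * σ k + - b * τ k)
    ≡⟨ recurrence a b (σ (suc k)) (σ k) (τ (suc k)) (τ k) ⟩
  a * σ (suc (suc k)) + b * τ (suc (suc k)) ∎
  where
  open ≡-Reasoning
  F = signedAffine a b
  k = length r
  shift : ∀ i → signedAffine a b (suc i) ≡ signedAffine (- (a + b)) (- b) i
  shift i rewrite ℤP.pos-+ 1 i = lemma (sgn i) a b (+ i)
    where
    lemma : ∀ s a b i → - s * (a + b * (+ 1 + i)) ≡ s * (- (a + b) + - b * i)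
    lemma = solve-∀
  recurrence : ∀ a b s1 s0 t1 t0 → (a * s1 + b * t1) + (- (a + b) * s0 + - b * t0)
               ≡ a * (s1 - s0) + b * (t1 - t0 - s0)
  recurrence = solve-∀

sgn≗signedAffine : ∀ r → sgn r ≡ signedAffine (+ 1) (+ 0) r
sgn≗signedAffine r = lemma (sgn r) (+ r)
  where
  lemma : ∀ s x → s ≡ s * (+ 1 + + 0 * x)
  lemma = solve-∀

matchingSum-path : ∀ xs → Unique xs → matchingSum sgn (pathEdges xs) ≡ σ (length xs)
matchingSum-path xs u = begin
  matchingSum sgn (pathEdges xs) ≡⟨ matchingSum-cong sgn≗signedAffine (pathEdges xs) ⟩
  matchingSum (signedAffine (+ 1) (+ 0)) (pathEdges xs) ≡⟨ matchingSum-path-signedAffine xs u (+ 1) (+ 0) ⟩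
  + 1 * σ (length xs) + + 0 * τ (length xs) ≡⟨ lemma (σ (length xs)) (τ (length xs)) ⟩
  σ (length xs) ∎
  where
  open ≡-Reasoning
  lemma : ∀ a b → + 1 * a + + 0 * b ≡ a
  lemma = solve-∀

matchingSum-sgn∘suc : ∀ L → matchingSum (sgn ∘ suc) L ≡ - matchingSum sgn L
matchingSum-sgn∘suc L = begin
  matchingSum (sgn ∘ suc) L ≡⟨ matchingSum-cong (λ r → sym (ℤP.-1*i≡-i (sgn r))) L ⟩
  matchingSum (λ r → - + 1 * sgn r) L ≡⟨ matchingSum-*ˡ (- + 1) sgn L ⟩
  - + 1 * matchingSum sgn L ≡⟨ ℤP.-1*i≡-i _ ⟩
  - matchingSum sgn L ∎
  where open ≡-Reasoning

matchingSum-path-++ : ∀ xs → Unique xs → ∀ L → (∀ {v} → v ∈ xs → All (T ∘ avoids v) L) →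
  matchingSum sgn (pathEdges xs ++ L) ≡ σ (length xs) * matchingSum sgn L
matchingSum-path-++ [] u L avoid = sym (ℤP.*-identityˡ _)
matchingSum-path-++ (x ∷ []) u L avoid = sym (ℤP.*-identityˡ _)
matchingSum-path-++ (x ∷ y ∷ r) u@(_ AllPairs.∷ u') L avoid = begin
  matchingSum sgn (sortedPair x y ∷ (pathEdges (y ∷ r) ++ L))
    ≡⟨ matchingSum-∷ sgn (sortedPair x y) (pathEdges (y ∷ r) ++ L) ⟩
  matchingSum sgn (pathEdges (y ∷ r) ++ L)
    + matchingSum (sgn ∘ suc) (filterᵇ (disjointℕ (sortedPair x y)) (pathEdges (y ∷ r) ++ L))
    ≡⟨ cong (λ L' → matchingSum sgn (pathEdges (y ∷ r) ++ L) + matchingSum (sgn ∘ suc) L') remaining ⟩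
  matchingSum sgn (pathEdges (y ∷ r) ++ L) + matchingSum (sgn ∘ suc) (pathEdges r ++ L)
    ≡⟨ cong (_+_ (matchingSum sgn (pathEdges (y ∷ r) ++ L))) (matchingSum-sgn∘suc (pathEdges r ++ L)) ⟩
  matchingSum sgn (pathEdges (y ∷ r) ++ L) - matchingSum sgn (pathEdges r ++ L)
    ≡⟨ cong₂ _-_ (matchingSum-path-++ (y ∷ r) u' L (avoid ∘ there))
                 (matchingSum-path-++ r (AllPairs.tail u') L (avoid ∘ there ∘ there)) ⟩
  σ (suc k) * S - σ k * S ≡⟨ factor (σ (suc k)) (σ k) S ⟩
  σ (suc (suc k)) * S ∎
  where
  open ≡-Reasoning
  k = length r
  S = matchingSum sgn L
  factor : ∀ a b s → a * s - b * s ≡ (a - b) * s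
  factor = solve-∀
  disjoint-L : All (T ∘ disjointℕ (sortedPair x y)) L
  disjoint-L = All.zipWith both (avoid (here refl) , avoid (there (here refl)))
    where
    both : ∀ {e} → T (avoids x e) × T (avoids y e) → T (disjointℕ (sortedPair x y) e)
    both {e} ax,ay = subst T (sym (disjointℕ-sortedPair x y e)) (Equivalence.from T-∧ ax,ay)
  remaining : filterᵇ (disjointℕ (sortedPair x y)) (pathEdges (y ∷ r) ++ L) ≡ pathEdges r ++ L
  remaining = trans (List.filter-++ (T? ∘ disjointℕ (sortedPair x y)) (pathEdges (y ∷ r)) L)
    (cong₂ _++_ (filter-disjoint-first-edge x y r (Unique[x∷xs]⇒x∉xs u ∘ there) (Unique[x∷xs]⇒x∉xs u'))
                (List.filter-all (T? ∘ disjointℕ (sortedPair x y)) disjoint-L))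

Unique-concatMap⁺ : ∀ {A B : Set} (f : A → List B) {xs} → Unique xs → (∀ x → Unique (f x)) →
  (∀ {x y b} → b ∈ f x → b ∈ f y → x ≡ y) → Unique (concatMap f xs)
Unique-concatMap⁺ f {xs} u uf shared =
  Unique.concat⁺ (All.map⁺ (All.universal uf xs))
                 (AllPairs.map⁺ (AllPairs.map (λ x≢y {_} (b∈x , b∈y) → x≢y (shared b∈x b∈y)) u))

Unique∧⊆∧⊇⇒↭ : ∀ {A : Set} {xs ys : List A} → Unique xs → Unique ys →
  (∀ {z} → z ∈ xs → z ∈ ys) → (∀ {z} → z ∈ ys → z ∈ xs) → xs ↭ ys
Unique∧⊆∧⊇⇒↭ ux uy xs⊆ys ys⊆xs = ∼bag⇒↭ (unique∧set⇒bag ux uy (mk⇔ xs⊆ys ys⊆xs))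

isEdgeᵇ : ∀ {n} → Graph n → Fin n → Fin n → Bool
isEdgeᵇ G i j = (toℕ i <ᵇ toℕ j) ∧ G i j

edgesFrom : ∀ {n} → Graph n → Fin n → Fin n → List (Edge n)
edgesFrom G i j = if isEdgeᵇ G i j then (i , j) ∷ [] else []

∈-edgesFrom : ∀ {n} (G : Graph n) i j {e} → e ∈ edgesFrom G i j → e ≡ (i , j) × T (isEdgeᵇ G i j)
∈-edgesFrom G i j e∈ with isEdgeᵇ G i j
∈-edgesFrom G i j (here refl) | true = refl , tt

∈-edges⁻ : ∀ {n} (G : Graph n) {i j} → (i , j) ∈ edges G → T (isEdgeᵇ G i j)
∈-edges⁻ {n} G e∈ with find (∈-concatMap⁻ (λ i → concatMap (edgesFrom G i) (allFin n)) {allFin n} e∈)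
... | i , _ , e∈ᵢ with find (∈-concatMap⁻ (edgesFrom G i) {allFin n} e∈ᵢ)
...   | j , _ , e∈ᵢⱼ with ∈-edgesFrom G i j e∈ᵢⱼ
...     | refl , isEdge = isEdge

∈-edges⁺ : ∀ {n} (G : Graph n) {i j} → T (isEdgeᵇ G i j) → (i , j) ∈ edges G
∈-edges⁺ {n} G {i} {j} isEdge = ∈-concatMap⁺ (λ i → concatMap (edgesFrom G i) (allFin n))
  (lose (∈-allFin i) (∈-concatMap⁺ (edgesFrom G i) (lose (∈-allFin j) ij∈)))
  where
  ij∈ : (i , j) ∈ edgesFrom G i j
  ij∈ with isEdgeᵇ G i j
  ... | true = here refl

edges-unique : ∀ {n} (G : Graph n) → Unique (edges G)
edges-unique {n} G = Unique-concatMap⁺ (λ i → concatMap (edgesFrom G i) (allFin n)) (Unique.allFin⁺ n)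
  (λ i → Unique-concatMap⁺ (edgesFrom G i) (Unique.allFin⁺ n) (edgesFrom-unique i) same-target)
  same-source
  where
  edgesFrom-unique : ∀ i j → Unique (edgesFrom G i j)
  edgesFrom-unique i j with isEdgeᵇ G i j
  ... | true = [] AllPairs.∷ AllPairs.[]
  ... | false = AllPairs.[]
  same-target : ∀ {i j j' e} → e ∈ edgesFrom G i j → e ∈ edgesFrom G i j' → j ≡ j'
  same-target {i} {j} {j'} e∈ e∈' with ∈-edgesFrom G i j e∈ | ∈-edgesFrom G i j' e∈'
  ... | refl , _ | refl , _ = refl
  same-source : ∀ {i i' e} → e ∈ concatMap (edgesFrom G i) (allFin n) → e ∈ concatMap (edgesFrom G i') (allFin n) → i ≡ i'
  same-source {i} {i'} e∈ e∈'
    with find (∈-concatMap⁻ (edgesFrom G i) {allFin n} e∈) | find (∈-concatMap⁻ (edgesFrom G i') {allFin n} e∈')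
  ... | j , _ , e∈ᵢⱼ | j' , _ , e∈ᵢ'ⱼ' with ∈-edgesFrom G i j e∈ᵢⱼ | ∈-edgesFrom G i' j' e∈ᵢ'ⱼ'
  ... | refl , _ | refl , _ = refl

toPair : ∀ {n} → Edge n → Pair
toPair (i , j) = toℕ i , toℕ j

edgePairs : ∀ {n} → Graph n → List Pair
edgePairs G = map toPair (edges G)

toPair-injective : ∀ {n} {x y : Edge n} → toPair x ≡ toPair y → x ≡ y
toPair-injective {x = i , j} {i' , j'} eq =
  cong₂ _,_ (Fin.toℕ-injective (cong proj₁ eq)) (Fin.toℕ-injective (cong proj₂ eq))

edgePairs-unique : ∀ {n} (G : Graph n) → Unique (edgePairs G)
edgePairs-unique G = Unique.map⁺ toPair-injective (edges-unique G)

allB-map : ∀ {A B : Set} (p : B → Bool) (h : A → B) L → allB p (map h L) ≡ allB (p ∘ h) L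
allB-map p h [] = refl
allB-map p h (x ∷ L) = cong (p (h x) ∧_) (allB-map p h L)

isMatching≡isMatchingℕ : ∀ {n} (M : List (Edge n)) → isMatching M ≡ isMatchingℕ (map toPair M)
isMatching≡isMatchingℕ [] = refl
isMatching≡isMatchingℕ (e ∷ M) =
  cong₂ _∧_ (sym (allB-map (disjointℕ (toPair e)) toPair M)) (isMatching≡isMatchingℕ M)

subsets-map : ∀ {A B : Set} (h : A → B) L → subsets (map h L) ≡ map (map h) (subsets L)
subsets-map h [] = refl
subsets-map h (x ∷ L) rewrite subsets-map h L =
  trans (cong (map (map h) (subsets L) ++_) (trans (sym (List.map-∘ (subsets L))) (List.map-∘ (subsets L))))
        (sym (List.map-++ (map h) (subsets L) (map (x ∷_) (subsets L))))

isMatchingℕ-map : ∀ {A : Set} (f g : A → Pair) → (∀ x y → disjointℕ (f x) (f y) ≡ disjointℕ (g x) (g y)) → ∀ L →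
  isMatchingℕ (map f L) ≡ isMatchingℕ (map g L)
isMatchingℕ-map f g same [] = refl
isMatchingℕ-map f g same (x ∷ L) =
  cong₂ _∧_ (trans (allB-map (disjointℕ (f x)) f L) (trans (allB-same L) (sym (allB-map (disjointℕ (g x)) g L))))
            (isMatchingℕ-map f g same L)
  where
  allB-same : ∀ L → allB (disjointℕ (f x) ∘ f) L ≡ allB (disjointℕ (g x) ∘ g) L
  allB-same [] = refl
  allB-same (y ∷ L) = cong₂ _∧_ (same x y) (allB-same L)

matchingSum-map : ∀ {A : Set} F (f g : A → Pair) → (∀ x y → disjointℕ (f x) (f y) ≡ disjointℕ (g x) (g y)) → ∀ L →
  matchingSum F (map f L) ≡ matchingSum F (map g L)
matchingSum-map F f g same L
  rewrite subsets-map f L | subsets-map g L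
        | sym (List.map-∘ {g = matchingWeight F} {f = map f} (subsets L))
        | sym (List.map-∘ {g = matchingWeight F} {f = map g} (subsets L))
  = sumℤ-cong weight≗ (subsets L)
  where
  weight≗ : ∀ M → matchingWeight F (map f M) ≡ matchingWeight F (map g M)
  weight≗ M rewrite isMatchingℕ-map f g same M | List.length-map f M | List.length-map g M = refl

filterᵇ-map : ∀ {A B : Set} (h : A → B) (f : B → Bool) L → map h (filterᵇ (f ∘ h) L) ≡ filterᵇ f (map h L)
filterᵇ-map h f [] = refl
filterᵇ-map h f (x ∷ L) with f (h x)
... | true = cong (h x ∷_) (filterᵇ-map h f L)
... | false = filterᵇ-map h f L

punchIn-<ᵇ : ∀ {n} (v : Fin (suc n)) (a b : Fin n) → (toℕ (punchIn v a) <ᵇ toℕ (punchIn v b)) ≡ (toℕ a <ᵇ toℕ b)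
punchIn-<ᵇ fzero a b = refl
punchIn-<ᵇ (fsuc v) fzero fzero = refl
punchIn-<ᵇ (fsuc v) fzero (fsuc b) = refl
punchIn-<ᵇ (fsuc v) (fsuc a) fzero = refl
punchIn-<ᵇ (fsuc v) (fsuc a) (fsuc b) = punchIn-<ᵇ v a b

punchIn-≡ᵇ : ∀ {n} (v : Fin (suc n)) (a b : Fin n) → (toℕ (punchIn v a) ≡ᵇ toℕ (punchIn v b)) ≡ (toℕ a ≡ᵇ toℕ b)
punchIn-≡ᵇ fzero a b = refl
punchIn-≡ᵇ (fsuc v) fzero fzero = refl
punchIn-≡ᵇ (fsuc v) fzero (fsuc b) = refl
punchIn-≡ᵇ (fsuc v) (fsuc a) fzero = refl
punchIn-≡ᵇ (fsuc v) (fsuc a) (fsuc b) = punchIn-≡ᵇ v a b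

punchInEdge : ∀ {n} → Fin (suc n) → Edge n → Edge (suc n)
punchInEdge v (i , j) = punchIn v i , punchIn v j

punchInEdge-injective : ∀ {n} (v : Fin (suc n)) {x y} → punchInEdge v x ≡ punchInEdge v y → x ≡ y
punchInEdge-injective v {a , b} {c , d} eq =
  cong₂ _,_ (Fin.punchIn-injective v a c (cong proj₁ eq)) (Fin.punchIn-injective v b d (cong proj₂ eq))

disjointℕ-punchInEdge : ∀ {n} (v : Fin (suc n)) x y →
  disjointℕ (toPair (punchInEdge v x)) (toPair (punchInEdge v y)) ≡ disjointℕ (toPair x) (toPair y)
disjointℕ-punchInEdge v (a , b) (c , d)
  rewrite punchIn-≡ᵇ v a c | punchIn-≡ᵇ v a d | punchIn-≡ᵇ v b c | punchIn-≡ᵇ v b d = refl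

avoidsEdge : ∀ {n} → Fin n → Edge n → Bool
avoidsEdge v e = avoids (toℕ v) (toPair e)

avoidsEdge-punchIn : ∀ {n} (v : Fin (suc n)) x e → avoidsEdge (punchIn v x) (punchInEdge v e) ≡ avoidsEdge x e
avoidsEdge-punchIn v x (a , b) rewrite punchIn-≡ᵇ v x a | punchIn-≡ᵇ v x b = refl

avoidsEdge-punchInEdge : ∀ {n} (v : Fin (suc n)) e → T (avoidsEdge v (punchInEdge v e))
avoidsEdge-punchInEdge v (a , b)
  rewrite ≢⇒≡ᵇ-false (toℕ v) (toℕ (punchIn v a)) (Fin.punchInᵢ≢i v a ∘ sym ∘ Fin.toℕ-injective)
        | ≢⇒≡ᵇ-false (toℕ v) (toℕ (punchIn v b)) (Fin.punchInᵢ≢i v b ∘ sym ∘ Fin.toℕ-injective) = tt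

avoidsEdge⇒≢ : ∀ {n} (v a b : Fin n) → T (avoidsEdge v (a , b)) → v ≢ a × v ≢ b
avoidsEdge⇒≢ v a b avoid = v≢a , v≢b
  where
  v≢a : v ≢ a
  v≢a refl rewrite ≡ᵇ-refl (toℕ v) = avoid
  v≢b : v ≢ b
  v≢b refl rewrite ≡ᵇ-refl (toℕ v) | Bool.∨-zeroʳ (toℕ v ≡ᵇ toℕ a) = avoid

edges-∖ : ∀ {n} (G : Graph (suc n)) v → map (punchInEdge v) (edges (G ∖ v)) ↭ filterᵇ (avoidsEdge v) (edges G)
edges-∖ G v = Unique∧⊆∧⊇⇒↭
  (Unique.map⁺ (punchInEdge-injective v) (edges-unique (G ∖ v)))
  (Unique.filter⁺ (T? ∘ avoidsEdge v) (edges-unique G)) ⊆ ⊇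
  where
  ⊆ : ∀ {e} → e ∈ map (punchInEdge v) (edges (G ∖ v)) → e ∈ filterᵇ (avoidsEdge v) (edges G)
  ⊆ e∈ with ∈-map⁻ (punchInEdge v) e∈
  ... | (i , j) , ij∈ , refl = ∈-filter⁺ (T? ∘ avoidsEdge v)
        (∈-edges⁺ G (subst (λ b → T (b ∧ G (punchIn v i) (punchIn v j))) (sym (punchIn-<ᵇ v i j))
                           (∈-edges⁻ (G ∖ v) ij∈)))
        (avoidsEdge-punchInEdge v (i , j))
  ⊇ : ∀ {e} → e ∈ filterᵇ (avoidsEdge v) (edges G) → e ∈ map (punchInEdge v) (edges (G ∖ v))
  ⊇ {a , b} e∈ with ∈-filter⁻ (T? ∘ avoidsEdge v) e∈
  ... | ab∈ , avoid with avoidsEdge⇒≢ v a b avoid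
  ... | v≢a , v≢b = subst (_∈ map (punchInEdge v) (edges (G ∖ v))) punchIn-ij
                      (∈-map⁺ (punchInEdge v) (∈-edges⁺ (G ∖ v) isEdge))
    where
    i = punchOut v≢a
    j = punchOut v≢b
    punchIn-ij : punchInEdge v (i , j) ≡ (a , b)
    punchIn-ij = cong₂ _,_ (Fin.punchIn-punchOut v≢a) (Fin.punchIn-punchOut v≢b)
    isEdge : T (isEdgeᵇ (G ∖ v) i j)
    isEdge = subst (λ b → T (b ∧ G (punchIn v i) (punchIn v j))) (punchIn-<ᵇ v i j)
               (subst (λ e → T (isEdgeᵇ G (proj₁ e) (proj₂ e))) (sym punchIn-ij) (∈-edges⁻ G ab∈))

matchingSum-∖ : ∀ {n} F (G : Graph (suc n)) v →
  matchingSum F (edgePairs (G ∖ v)) ≡ matchingSum F (filterᵇ (avoids (toℕ v)) (edgePairs G))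
matchingSum-∖ F G v = begin
  matchingSum F (map toPair (edges (G ∖ v)))
    ≡⟨ sym (matchingSum-map F (toPair ∘ punchInEdge v) toPair (disjointℕ-punchInEdge v) (edges (G ∖ v))) ⟩
  matchingSum F (map (toPair ∘ punchInEdge v) (edges (G ∖ v))) ≡⟨ cong (matchingSum F) (List.map-∘ (edges (G ∖ v))) ⟩
  matchingSum F (map toPair (map (punchInEdge v) (edges (G ∖ v)))) ≡⟨ matchingSum-↭ F (↭.map⁺ toPair (edges-∖ G v)) ⟩
  matchingSum F (map toPair (filterᵇ (avoidsEdge v) (edges G)))
    ≡⟨ cong (matchingSum F) (filterᵇ-map toPair (avoids (toℕ v)) (edges G)) ⟩
  matchingSum F (filterᵇ (avoids (toℕ v)) (edgePairs G)) ∎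
  where open ≡-Reasoning

matchingSum-∖∖ : ∀ {n} F (G : Graph (suc (suc n))) v x →
  matchingSum F (edgePairs ((G ∖ v) ∖ x))
    ≡ matchingSum F (filterᵇ (avoids (toℕ (punchIn v x))) (filterᵇ (avoids (toℕ v)) (edgePairs G)))
matchingSum-∖∖ F G v x = begin
  matchingSum F (edgePairs ((G ∖ v) ∖ x)) ≡⟨ matchingSum-∖ F (G ∖ v) x ⟩
  matchingSum F (filterᵇ (avoids (toℕ x)) (map toPair (edges (G ∖ v))))
    ≡⟨ cong (matchingSum F) (sym (filterᵇ-map toPair (avoids (toℕ x)) (edges (G ∖ v)))) ⟩
  matchingSum F (map toPair Eₓ) ≡⟨ sym (matchingSum-map F (toPair ∘ punchInEdge v) toPair (disjointℕ-punchInEdge v) Eₓ) ⟩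
  matchingSum F (map (toPair ∘ punchInEdge v) Eₓ) ≡⟨ cong (matchingSum F) (List.map-∘ Eₓ) ⟩
  matchingSum F (map toPair (map (punchInEdge v) Eₓ))
    ≡⟨ cong (matchingSum F ∘ map toPair)
         (trans (cong (map (punchInEdge v)) (filterᵇ-cong (λ e → sym (avoidsEdge-punchIn v x e)) (edges (G ∖ v))))
                (filterᵇ-map (punchInEdge v) (avoidsEdge (punchIn v x)) (edges (G ∖ v)))) ⟩
  matchingSum F (map toPair (filterᵇ (avoidsEdge (punchIn v x)) (map (punchInEdge v) (edges (G ∖ v)))))
    ≡⟨ matchingSum-↭ F (↭.map⁺ toPair (↭.filter-↭ (T? ∘ avoidsEdge (punchIn v x)) (edges-∖ G v))) ⟩
  matchingSum F (map toPair (filterᵇ (avoidsEdge (punchIn v x)) (filterᵇ (avoidsEdge v) (edges G))))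
    ≡⟨ cong (matchingSum F) (filterᵇ-map toPair (avoids (toℕ (punchIn v x))) (filterᵇ (avoidsEdge v) (edges G))) ⟩
  matchingSum F (filterᵇ (avoids (toℕ (punchIn v x))) (map toPair (filterᵇ (avoidsEdge v) (edges G))))
    ≡⟨ cong (matchingSum F ∘ filterᵇ (avoids (toℕ (punchIn v x)))) (filterᵇ-map toPair (avoids (toℕ v)) (edges G)) ⟩
  matchingSum F (filterᵇ (avoids (toℕ (punchIn v x))) (filterᵇ (avoids (toℕ v)) (edgePairs G))) ∎
  where
  open ≡-Reasoning
  Eₓ = filterᵇ (avoidsEdge x) (edges (G ∖ v))

lookup-injective : ∀ {A : Set} {xs : List A} → Unique xs → ∀ i j → lookup xs i ≡ lookup xs j → i ≡ j
lookup-injective {xs = x ∷ xs} u fzero fzero eq = refl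
lookup-injective {xs = x ∷ xs} u fzero (fsuc j) eq = ⊥-elim (Unique[x∷xs]⇒x∉xs u (subst (_∈ xs) (sym eq) (∈-lookup j)))
lookup-injective {xs = x ∷ xs} u (fsuc i) fzero eq = ⊥-elim (Unique[x∷xs]⇒x∉xs u (subst (_∈ xs) eq (∈-lookup i)))
lookup-injective {xs = x ∷ xs} (_ AllPairs.∷ u) (fsuc i) (fsuc j) eq = cong fsuc (lookup-injective u i j eq)

Unique⇒length≤ : ∀ {n} {xs : List (Fin n)} → Unique xs → length xs ≤ n
Unique⇒length≤ {xs = xs} u = Fin.injective⇒≤ {f = lookup xs} (λ {i} {j} → lookup-injective u i j)

endpoints : ∀ {n} → List (Edge n) → List (Fin n)
endpoints [] = []
endpoints ((i , j) ∷ M) = i ∷ j ∷ endpoints M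

length-endpoints : ∀ {n} (M : List (Edge n)) → length (endpoints M) ≡ 2 ℕ.* length M
length-endpoints [] = refl
length-endpoints ((i , j) ∷ M) rewrite length-endpoints M = cong suc (sym (ℕP.+-suc (length M) (length M ℕ.+ 0)))

∈-endpoints⁻ : ∀ {n} (M : List (Edge n)) {x} → x ∈ endpoints M → ∃ λ e → e ∈ M × (x ≡ proj₁ e ⊎ x ≡ proj₂ e)
∈-endpoints⁻ ((i , j) ∷ M) (here refl) = (i , j) , here refl , inj₁ refl
∈-endpoints⁻ ((i , j) ∷ M) (there (here refl)) = (i , j) , here refl , inj₂ refl
∈-endpoints⁻ ((i , j) ∷ M) (there (there x∈)) with ∈-endpoints⁻ M x∈
... | e , e∈ , x∈e = e , there e∈ , x∈e

allB-∈ : ∀ {A : Set} (f : A → Bool) {L x} → T (allB f L) → x ∈ L → T (f x)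
allB-∈ f {y ∷ L} all (here refl) = proj₁ (Equivalence.to T-∧ all)
allB-∈ f {y ∷ L} all (there x∈) = allB-∈ f (proj₂ (Equivalence.to (T-∧ {f y}) all)) x∈

disjointE⇒≢ : ∀ {n} {a b c d : Fin n} → T (disjointE (a , b) (c , d)) → a ≢ c × a ≢ d × b ≢ c × b ≢ d
disjointE⇒≢ {n} {a} {b} {c} {d} disj
  with toℕ a ≡ᵇ toℕ c in ac | toℕ a ≡ᵇ toℕ d in ad | toℕ b ≡ᵇ toℕ c in bc | toℕ b ≡ᵇ toℕ d in bd
... | false | false | false | false = ≢ ac , ≢ ad , ≢ bc , ≢ bd
  where
  ≢ : ∀ {x y : Fin n} → (toℕ x ≡ᵇ toℕ y) ≡ false → x ≢ y
  ≢ {x} x≢ᵇx refl rewrite ≡ᵇ-refl (toℕ x) with x≢ᵇx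
  ... | ()

-- Edges are stored as (i , j) with i < j, so a matching has pairwise distinct endpoints.
endpoints-unique : ∀ {n} (M : List (Edge n)) → All (λ e → T (toℕ (proj₁ e) <ᵇ toℕ (proj₂ e))) M →
  T (isMatching M) → Unique (endpoints M)
endpoints-unique [] _ _ = AllPairs.[]
endpoints-unique ((i , j) ∷ M) (i<j ∷ ordered) matching =
  ¬Any⇒All¬ (j ∷ endpoints M) i∉ AllPairs.∷ (¬Any⇒All¬ (endpoints M) j∉ AllPairs.∷ endpoints-unique M ordered rest)
  where
  first = proj₁ (Equivalence.to T-∧ matching)
  rest = proj₂ (Equivalence.to (T-∧ {allB (disjointE (i , j)) M}) matching)
  far : ∀ {x} → x ∈ endpoints M → i ≢ x × j ≢ x
  far x∈ with ∈-endpoints⁻ M x∈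
  ... | (c , d) , e∈ , x∈e with disjointE⇒≢ (allB-∈ (disjointE (i , j)) first e∈) | x∈e
  ... | i≢c , i≢d , j≢c , j≢d | inj₁ refl = i≢c , j≢c
  ... | i≢c , i≢d , j≢c , j≢d | inj₂ refl = i≢d , j≢d
  i∉ : i ∉ j ∷ endpoints M
  i∉ (here refl) = ℕP.<-irrefl refl (ℕP.<ᵇ⇒< (toℕ i) (toℕ i) i<j)
  i∉ (there x∈) = proj₁ (far x∈) refl
  j∉ : j ∉ endpoints M
  j∉ x∈ = proj₂ (far x∈) refl

∈-subsets⇒⊆ : ∀ {A : Set} (L : List A) {M} → M ∈ subsets L → ∀ {x} → x ∈ M → x ∈ L
∈-subsets⇒⊆ [] (here refl) ()
∈-subsets⇒⊆ (y ∷ L) M∈ x∈ with ∈-++⁻ (subsets L) M∈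
... | inj₁ M∈' = there (∈-subsets⇒⊆ L M∈' x∈)
... | inj₂ M∈' with ∈-map⁻ (y ∷_) M∈' | x∈
...   | M' , M'∈ , refl | here refl = here refl
...   | M' , M'∈ , refl | there x∈' = there (∈-subsets⇒⊆ L M'∈ x∈')

matching-size-bound : ∀ {n} (G : Graph n) {M} → M ∈ subsets (edges G) → T (isMatching M) → 2 ℕ.* length M ≤ n
matching-size-bound G {M} M∈ matching =
  subst (_≤ _) (length-endpoints M) (Unique⇒length≤ (endpoints-unique M ordered matching))
  where
  ordered = All.tabulate (λ x∈ → proj₁ (Equivalence.to T-∧ (∈-edges⁻ G (∈-subsets⇒⊆ (edges G) M∈ x∈))))

-- μ(G, 1), μ′(G, 1) and the multiplicity of the root 1

indicator : Bool → ℤ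
indicator b = if b then + 1 else + 0

+length-filterᵇ : ∀ {A : Set} (P : A → Bool) X → + length (filterᵇ P X) ≡ sumℤ (map (indicator ∘ P) X)
+length-filterᵇ P [] = refl
+length-filterᵇ P (x ∷ X) with P x
... | true = trans (ℤP.pos-+ 1 _) (cong (_+_ (+ 1)) (+length-filterᵇ P X))
... | false = trans (+length-filterᵇ P X) (sym (ℤP.+-identityˡ _))

sumℤ-if : ∀ {A : Set} (Q : A → Bool) c X →
  sumℤ (map (λ x → if Q x then c else + 0) X) ≡ c * sumℤ (map (indicator ∘ Q) X)
sumℤ-if Q c [] = sym (ℤP.*-zeroʳ c)
sumℤ-if Q c (x ∷ X) rewrite sumℤ-if Q c X with Q x
... | true = trans (cong (_+ c * sumℤ (map (indicator ∘ Q) X)) (sym (ℤP.*-identityʳ c)))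
                   (sym (ℤP.*-distribˡ-+ c (+ 1) _))
... | false = trans (ℤP.+-identityˡ _) (cong (c *_) (sym (ℤP.+-identityˡ _)))

sumℤ-map-+ : ∀ {A : Set} (f g : A → ℤ) X → sumℤ (map (λ x → f x + g x) X) ≡ sumℤ (map f X) + sumℤ (map g X)
sumℤ-map-+ f g [] = refl
sumℤ-map-+ f g (x ∷ X) rewrite sumℤ-map-+ f g X = interchange (f x) (g x) (sumℤ (map f X)) (sumℤ (map g X))
  where
  interchange : ∀ a b c d → a + b + (c + d) ≡ a + c + (b + d)
  interchange = solve-∀

applyUpTo-cong : ∀ {A : Set} {f g : ℕ → A} N → (∀ i → i < N → f i ≡ g i) → applyUpTo f N ≡ applyUpTo g N
applyUpTo-cong zero f≗g = refl
applyUpTo-cong (suc N) f≗g = cong₂ _∷_ (f≗g 0 (s≤s z≤n)) (applyUpTo-cong N (λ i i<N → f≗g (suc i) (s≤s i<N)))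

sumℤ-applyUpTo-zero : ∀ N → sumℤ (applyUpTo (λ _ → + 0) N) ≡ + 0
sumℤ-applyUpTo-zero zero = refl
sumℤ-applyUpTo-zero (suc N) = trans (ℤP.+-identityˡ _) (sumℤ-applyUpTo-zero N)

sumℤ-interchange : ∀ {A : Set} N (k : ℕ → A → ℤ) X →
  sumℤ (applyUpTo (λ i → sumℤ (map (k i) X)) N) ≡ sumℤ (map (λ x → sumℤ (applyUpTo (λ i → k i x) N)) X)
sumℤ-interchange zero k X = sym (sumℤ-zero X)
sumℤ-interchange (suc N) k X rewrite sumℤ-interchange N (k ∘ suc) X =
  sym (sumℤ-map-+ (k 0) (λ x → sumℤ (applyUpTo (λ i → k (suc i) x) N)) X)

sumℤ-applyUpTo-delta : ∀ N c a → sumℤ (applyUpTo (λ i → if i ≡ᵇ c then a else + 0) N) ≡ (if c <ᵇ N then a else + 0)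
sumℤ-applyUpTo-delta zero c a = refl
sumℤ-applyUpTo-delta (suc N) zero a = trans (cong (_+_ a) (zeros N)) (ℤP.+-identityʳ a)
  where
  zeros : ∀ N → sumℤ (applyUpTo (λ i → if suc i ≡ᵇ 0 then a else + 0) N) ≡ + 0
  zeros zero = refl
  zeros (suc N) = trans (ℤP.+-identityˡ _) (zeros N)
sumℤ-applyUpTo-delta (suc N) (suc c) a = trans (ℤP.+-identityˡ _) (sumℤ-applyUpTo-delta N c a)

-- Index i carries the r-matchings with i = 2r.
even-half-delta : ∀ i r (H : ℕ → ℤ) →
  (if i % 2 ≡ᵇ 0 then (if r ≡ᵇ i / 2 then H i else + 0) else + 0) ≡ (if i ≡ᵇ r ℕ.* 2 then H (r ℕ.* 2) else + 0)
even-half-delta i r H with i ≡ᵇ r ℕ.* 2 in i≡2r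
... | true = subst (λ j → (if j % 2 ≡ᵇ 0 then (if r ≡ᵇ j / 2 then H j else + 0) else + 0) ≡ H (r ℕ.* 2))
                 (sym (ℕP.≡ᵇ⇒≡ i (r ℕ.* 2) (subst T (sym i≡2r) tt))) at-2r
  where
  2r%2≡0 : r ℕ.* 2 % 2 ≡ 0
  2r%2≡0 = ℕ.m*n%n≡0 r 2
  2r/2≡r : r ℕ.* 2 / 2 ≡ r
  2r/2≡r = ℕ.m*n/n≡m r 2
  at-2r : (if r ℕ.* 2 % 2 ≡ᵇ 0 then (if r ≡ᵇ r ℕ.* 2 / 2 then H (r ℕ.* 2) else + 0) else + 0) ≡ H (r ℕ.* 2)
  at-2r rewrite 2r%2≡0 | 2r/2≡r | ≡ᵇ-refl r = refl
... | false with i % 2 ≡ᵇ 0 in even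
...   | false = refl
...   | true with r ≡ᵇ i / 2 in half
...     | false = refl
...     | true rewrite ℕP.≡ᵇ⇒≡ r (i / 2) (subst T (sym half) tt) = contradiction i≡2r
  where
  i≡half*2 : i ≡ i / 2 ℕ.* 2
  i≡half*2 = trans (ℕ.m≡m%n+[m/n]*n i 2) (cong (ℕ._+ i / 2 ℕ.* 2) (ℕP.≡ᵇ⇒≡ (i % 2) 0 (subst T (sym even) tt)))
  contradiction : (i ≡ᵇ i / 2 ℕ.* 2) ≡ false → _
  contradiction eq with trans (sym (cong (_≡ᵇ i / 2 ℕ.* 2) i≡half*2)) eq
  ... | eq' rewrite ≡ᵇ-refl (i / 2 ℕ.* 2) with eq'
  ... | ()

sumℤ-μcoeff* : ∀ {n} (G : Graph n) (g : ℕ → ℤ) →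
  sumℤ (applyUpTo (λ i → μcoeff G i * g i) (suc n)) ≡ matchingSum (λ r → sgn r * g (r ℕ.* 2)) (edgePairs G)
sumℤ-μcoeff* {n} G g = begin
  sumℤ (applyUpTo (λ i → μcoeff G i * g i) (suc n))
    ≡⟨ cong sumℤ (applyUpTo-cong (suc n) (λ i _ → coefficient i)) ⟩
  sumℤ (applyUpTo (λ i → sumℤ (map (κ i) X)) (suc n)) ≡⟨ sumℤ-interchange (suc n) κ X ⟩
  sumℤ (map (λ M → sumℤ (applyUpTo (λ i → κ i M) (suc n))) X) ≡⟨ sumℤ-cong∈ X per-subset ⟩
  sumℤ (map (matchingWeight F ∘ map toPair) X) ≡⟨ cong sumℤ (List.map-∘ X) ⟩
  sumℤ (map (matchingWeight F) (map (map toPair) X))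
    ≡⟨ cong (sumℤ ∘ map (matchingWeight F)) (sym (subsets-map toPair (edges G))) ⟩
  matchingSum F (edgePairs G) ∎
  where
  open ≡-Reasoning
  X = subsets (edges G)
  F = λ r → sgn r * g (r ℕ.* 2)
  κ : ℕ → List (Edge n) → ℤ
  κ i M = if i % 2 ≡ᵇ 0 then (if (length M ≡ᵇ i / 2) ∧ isMatching M then sgn (i / 2) * g i else + 0) else + 0
  coefficient : ∀ i → μcoeff G i * g i ≡ sumℤ (map (κ i) X)
  coefficient i with i % 2 ≡ᵇ 0
  ... | false = sym (sumℤ-zero X)
  ... | true = begin
    sgn (i / 2) * + p G (i / 2) * g i
      ≡⟨ cong (λ c → sgn (i / 2) * c * g i) (+length-filterᵇ Q X) ⟩
    sgn (i / 2) * sumℤ (map (indicator ∘ Q) X) * g i ≡⟨ rearrange (sgn (i / 2)) _ (g i) ⟩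
    (sgn (i / 2) * g i) * sumℤ (map (indicator ∘ Q) X) ≡⟨ sym (sumℤ-if Q (sgn (i / 2) * g i) X) ⟩
    sumℤ (map (λ M → if Q M then sgn (i / 2) * g i else + 0) X) ∎
    where
    Q = λ M → (length M ≡ᵇ i / 2) ∧ isMatching M
    rearrange : ∀ a b c → a * b * c ≡ (a * c) * b
    rearrange = solve-∀
  per-matching : ∀ M b → (T b → length M ℕ.* 2 ≤ n) →
    sumℤ (applyUpTo (λ i → if i % 2 ≡ᵇ 0 then (if (length M ≡ᵇ i / 2) ∧ b then sgn (i / 2) * g i else + 0) else + 0) (suc n))
      ≡ (if b then F (length M) else + 0)
  per-matching M false _ = trans (cong sumℤ (applyUpTo-cong (suc n) (λ i _ → vanish i))) (sumℤ-applyUpTo-zero (suc n))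
    where
    vanish : ∀ i → (if i % 2 ≡ᵇ 0 then (if (length M ≡ᵇ i / 2) ∧ false then sgn (i / 2) * g i else + 0) else + 0) ≡ + 0
    vanish i rewrite Bool.∧-zeroʳ (length M ≡ᵇ i / 2) with i % 2 ≡ᵇ 0
    ... | true = refl
    ... | false = refl
  per-matching M true bound = begin
    sumℤ (applyUpTo (λ i → if i % 2 ≡ᵇ 0 then (if (r ≡ᵇ i / 2) ∧ true then H i else + 0) else + 0) (suc n))
      ≡⟨ cong sumℤ (applyUpTo-cong (suc n) (λ i _ → trans (cong (λ b → if i % 2 ≡ᵇ 0 then (if b then H i else + 0) else + 0)
                                                                (Bool.∧-identityʳ (r ≡ᵇ i / 2)))
                                                          (even-half-delta i r H))) ⟩
    sumℤ (applyUpTo (λ i → if i ≡ᵇ r ℕ.* 2 then H (r ℕ.* 2) else + 0) (suc n))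
      ≡⟨ sumℤ-applyUpTo-delta (suc n) (r ℕ.* 2) (H (r ℕ.* 2)) ⟩
    (if r ℕ.* 2 <ᵇ suc n then H (r ℕ.* 2) else + 0)
      ≡⟨ cong (λ b → if b then H (r ℕ.* 2) else + 0) (<⇒<ᵇ (s≤s (bound tt))) ⟩
    H (r ℕ.* 2) ≡⟨ cong (λ k → sgn k * g (r ℕ.* 2)) (ℕ.m*n/n≡m r 2) ⟩
    F r ∎
    where
    r = length M
    H = λ j → sgn (j / 2) * g j
    <⇒<ᵇ : ∀ {a b} → a < b → (a <ᵇ b) ≡ true
    <⇒<ᵇ {a} {b} a<b with a <ᵇ b | ℕP.<⇒<ᵇ a<b
    ... | true | _ = refl
  per-subset : ∀ {M} → M ∈ X → sumℤ (applyUpTo (λ i → κ i M) (suc n)) ≡ matchingWeight F (map toPair M)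
  per-subset {M} M∈ rewrite sym (isMatching≡isMatchingℕ M) | List.length-map toPair M =
    per-matching M (isMatching M) (λ matching → subst (_≤ n) (ℕP.*-comm 2 (length M)) (matching-size-bound G M∈ matching))

derivativeAt1 : List ℤ → ℤ
derivativeAt1 [] = + 0
derivativeAt1 (a ∷ as) = a * + length as + derivativeAt1 as

derivativeAt1-applyUpTo : ∀ N (h : ℕ → ℤ) →
  derivativeAt1 (applyUpTo h N) ≡ sumℤ (applyUpTo (λ i → h i * + (N ∸ suc i)) N)
derivativeAt1-applyUpTo zero h = refl
derivativeAt1-applyUpTo (suc N) h rewrite List.length-applyUpTo (h ∘ suc) N | derivativeAt1-applyUpTo N (h ∘ suc) = refl

μ≡applyUpTo : ∀ {n} (G : Graph n) → μ G ≡ applyUpTo (μcoeff G) (suc n)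
μ≡applyUpTo {n} G = List.map-upTo (μcoeff G) (suc n)

μ-at-1 : ∀ {n} (G : Graph n) → sumℤ (μ G) ≡ matchingSum sgn (edgePairs G)
μ-at-1 {n} G = begin
  sumℤ (μ G) ≡⟨ cong sumℤ (μ≡applyUpTo G) ⟩
  sumℤ (applyUpTo (μcoeff G) (suc n))
    ≡⟨ cong sumℤ (applyUpTo-cong (suc n) (λ i _ → sym (ℤP.*-identityʳ (μcoeff G i)))) ⟩
  sumℤ (applyUpTo (λ i → μcoeff G i * + 1) (suc n)) ≡⟨ sumℤ-μcoeff* G (λ _ → + 1) ⟩
  matchingSum (λ r → sgn r * + 1) (edgePairs G) ≡⟨ matchingSum-cong (ℤP.*-identityʳ ∘ sgn) (edgePairs G) ⟩
  matchingSum sgn (edgePairs G) ∎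
  where open ≡-Reasoning

μ′-at-1 : ∀ {n} (G : Graph n) → derivativeAt1 (μ G) ≡ matchingSum (signedAffine (+ n) (- + 2)) (edgePairs G)
μ′-at-1 {n} G = begin
  derivativeAt1 (μ G) ≡⟨ cong derivativeAt1 (μ≡applyUpTo G) ⟩
  derivativeAt1 (applyUpTo (μcoeff G) (suc n)) ≡⟨ derivativeAt1-applyUpTo (suc n) (μcoeff G) ⟩
  sumℤ (applyUpTo (λ i → μcoeff G i * + (suc n ∸ suc i)) (suc n))
    ≡⟨ cong sumℤ (applyUpTo-cong (suc n) (λ i i<1+n → cong (μcoeff G i *_) (degree i (ℕP.≤-pred i<1+n)))) ⟩
  sumℤ (applyUpTo (λ i → μcoeff G i * (+ n - + i)) (suc n)) ≡⟨ sumℤ-μcoeff* G (λ i → + n - + i) ⟩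
  matchingSum (λ r → sgn r * (+ n - + (r ℕ.* 2))) (edgePairs G) ≡⟨ matchingSum-cong affine (edgePairs G) ⟩
  matchingSum (signedAffine (+ n) (- + 2)) (edgePairs G) ∎
  where
  open ≡-Reasoning
  degree : ∀ i → i ≤ n → + (suc n ∸ suc i) ≡ + n - + i
  degree i i≤n = trans (sym (ℤP.⊖-≥ i≤n)) (sym (ℤP.m-n≡m⊖n n i))
  affine : ∀ r → sgn r * (+ n - + (r ℕ.* 2)) ≡ signedAffine (+ n) (- + 2) r
  affine r rewrite ℤP.pos-* r 2 = lemma (sgn r) (+ n) (+ r)
    where
    lemma : ∀ s a x → s * (a - x * + 2) ≡ s * (a + - + 2 * x)
    lemma = solve-∀

synth-1-remainder : ∀ a as → proj₂ (synth (+ 1) (a ∷ as)) ≡ sumℤ (a ∷ as)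
synth-1-remainder a [] = sym (ℤP.+-identityʳ a)
synth-1-remainder a (b ∷ bs) = trans (synth-1-remainder (b + + 1 * a) bs) (lemma a b (sumℤ bs))
  where
  lemma : ∀ a b c → (b + + 1 * a) + c ≡ a + (b + c)
  lemma = solve-∀

synth-1-quotient : ∀ a as → sumℤ (proj₁ (synth (+ 1) (a ∷ as))) ≡ derivativeAt1 (a ∷ as)
synth-1-quotient a [] = lemma a
  where
  lemma : ∀ a → + 0 ≡ a * + 0 + + 0
  lemma = solve-∀
synth-1-quotient a (b ∷ bs) = begin
  a + sumℤ (proj₁ (synth (+ 1) (b + + 1 * a ∷ bs))) ≡⟨ cong (_+_ a) (synth-1-quotient (b + + 1 * a) bs) ⟩
  a + ((b + + 1 * a) * + length bs + derivativeAt1 bs) ≡⟨ lemma a b (+ length bs) (derivativeAt1 bs) ⟩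
  a * (+ 1 + + length bs) + (b * + length bs + derivativeAt1 bs)
    ≡⟨ cong (λ k → a * k + (b * + length bs + derivativeAt1 bs)) (sym (ℤP.pos-+ 1 (length bs))) ⟩
  derivativeAt1 (a ∷ b ∷ bs) ∎
  where
  open ≡-Reasoning
  lemma : ∀ a b k d → a + ((b + + 1 * a) * k + d) ≡ a * (+ 1 + k) + (b * k + d)
  lemma = solve-∀

∣∣≡ᵇ0-false : ∀ x → x ≢ + 0 → (∣ x ∣ ≡ᵇ 0) ≡ false
∣∣≡ᵇ0-false x x≢0 = ≢⇒≡ᵇ-false ∣ x ∣ 0 (x≢0 ∘ ℤP.∣i∣≡0⇒i≡0)

multAux-1≡0 : ∀ k a as → sumℤ (a ∷ as) ≢ + 0 → multAux (suc k) (+ 1) (a ∷ as) ≡ 0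
multAux-1≡0 k a as nonroot rewrite synth-1-remainder a as | ∣∣≡ᵇ0-false (sumℤ (a ∷ as)) nonroot = refl

multAux-1≡1 : ∀ k a b bs → sumℤ (a ∷ b ∷ bs) ≡ + 0 → derivativeAt1 (a ∷ b ∷ bs) ≢ + 0 →
  multAux (suc (suc k)) (+ 1) (a ∷ b ∷ bs) ≡ 1
multAux-1≡1 k a b bs root simple rewrite synth-1-remainder a (b ∷ bs) | root =
  cong suc (multAux-1≡0 k a (proj₁ (synth (+ 1) (b + + 1 * a ∷ bs))) (simple ∘ trans (sym (synth-1-quotient a (b ∷ bs)))))

mult-1≡0 : ∀ {n} (G : Graph n) → matchingSum sgn (edgePairs G) ≢ + 0 → mult (+ 1) G ≡ 0
mult-1≡0 {zero} G _ = refl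
mult-1≡0 {suc n} G nonroot =
  multAux-1≡0 n (μcoeff G 0) (map (μcoeff G) (applyUpTo suc (suc n))) (nonroot ∘ trans (sym (μ-at-1 G)))

mult-1≡1 : ∀ {n} (G : Graph (suc (suc n))) → matchingSum sgn (edgePairs G) ≡ + 0 →
  matchingSum (signedAffine (+ suc (suc n)) (- + 2)) (edgePairs G) ≢ + 0 → mult (+ 1) G ≡ 1
mult-1≡1 {n} G root simple =
  multAux-1≡1 n (μcoeff G 0) (μcoeff G 1) (map (μcoeff G) (applyUpTo (suc ∘ suc) (suc n)))
    (trans (μ-at-1 G) root) (simple ∘ trans (sym (μ′-at-1 G)))

-- The edge list of the cycle

range : ℕ → ℕ → List ℕ
range k zero = []
range k (suc m) = k ∷ range (suc k) m

length-range : ∀ k m → length (range k m) ≡ m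
length-range k zero = refl
length-range k (suc m) = cong suc (length-range (suc k) m)

∈-range⁻ : ∀ k m {z} → z ∈ range k m → k ≤ z × z < k ℕ.+ m
∈-range⁻ k (suc m) (here refl) = ℕP.≤-refl , subst (k <_) (sym (ℕP.+-suc k m)) (s≤s (ℕP.m≤m+n k m))
∈-range⁻ k (suc m) {z} (there z∈) with ∈-range⁻ (suc k) m z∈
... | k<z , z<k+m = ℕP.<⇒≤ k<z , subst (z <_) (sym (ℕP.+-suc k m)) z<k+m

∈-range⁺ : ∀ k m {z} → k ≤ z → z < k ℕ.+ m → z ∈ range k m
∈-range⁺ k zero {z} k≤z z<k = ⊥-elim (ℕP.<⇒≱ z<k (subst (_≤ z) (sym (ℕP.+-identityʳ k)) k≤z))
∈-range⁺ k (suc m) {z} k≤z z<k+m with k ≟ z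
... | yes refl = here refl
... | no k≢z = there (∈-range⁺ (suc k) m (ℕP.≤∧≢⇒< k≤z k≢z) (subst (z <_) (ℕP.+-suc k m) z<k+m))

range-unique : ∀ k m → Unique (range k m)
range-unique k zero = AllPairs.[]
range-unique k (suc m) =
  ¬Any⇒All¬ (range (suc k) m) (ℕP.<-irrefl refl ∘ proj₁ ∘ ∈-range⁻ (suc k) m) AllPairs.∷ range-unique (suc k) m

range-split : ∀ k v m → range k (v ℕ.+ suc m) ≡ range k v ++ (k ℕ.+ v) ∷ range (suc (k ℕ.+ v)) m
range-split k zero m rewrite ℕP.+-identityʳ k = refl
range-split k (suc v) m rewrite range-split (suc k) v m | ℕP.+-suc k v = refl

pathEdges-range-∷ʳ : ∀ k m z → pathEdges (range k (suc m) ++ z ∷ []) ≡ pathEdges (range k (suc m)) ++ sortedPair (k ℕ.+ m) z ∷ []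
pathEdges-range-∷ʳ k zero z rewrite ℕP.+-identityʳ k = refl
pathEdges-range-∷ʳ k (suc m) z rewrite pathEdges-range-∷ʳ (suc k) m z | ℕP.+-suc k m = refl

sortedPair-< : ∀ {a b} → a < b → sortedPair a b ≡ (a , b)
sortedPair-< {a} {b} a<b with a <ᵇ b | ℕP.<⇒<ᵇ a<b
... | true | _ = refl

∈-pathEdges-range⁻ : ∀ k m {a b} → (a , b) ∈ pathEdges (range k m) → k ≤ a × b ≡ suc a × b < k ℕ.+ m
∈-pathEdges-range⁻ k (suc (suc m)) (here eq) rewrite sortedPair-< (ℕP.n<1+n k) with eq
... | refl = ℕP.≤-refl , refl , subst (suc k <_) (sym (trans (ℕP.+-suc k (suc m)) (cong suc (ℕP.+-suc k m))))
                                         (s≤s (s≤s (ℕP.m≤m+n k m)))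
∈-pathEdges-range⁻ k (suc (suc m)) {b = b} (there ab∈) with ∈-pathEdges-range⁻ (suc k) (suc m) ab∈
... | k<a , b≡1+a , b<k+m = ℕP.<⇒≤ k<a , b≡1+a , subst (b <_) (sym (ℕP.+-suc k (suc m))) b<k+m

∈-pathEdges-range⁺ : ∀ m k {a} → k ≤ a → suc a < k ℕ.+ m → (a , suc a) ∈ pathEdges (range k m)
∈-pathEdges-range⁺ zero k k≤a 1+a<k = ⊥-elim (ℕP.<-asym 1+a<k (subst (_< _) (sym (ℕP.+-identityʳ k)) (s≤s k≤a)))
∈-pathEdges-range⁺ (suc zero) k {a} k≤a 1+a<1+k =
  ⊥-elim (ℕP.<-irrefl refl (ℕP.≤-trans 1+a<1+k (subst (_≤ suc a) (ℕP.+-comm 1 k) (s≤s k≤a))))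
∈-pathEdges-range⁺ (suc (suc m)) k {a} k≤a 1+a<k+m with k ≟ a | ∈-pathEdges-range⁺ (suc m) (suc k) {a}
... | yes refl | _ = here (sym (sortedPair-< (ℕP.n<1+n k)))
... | no k≢a | later = there (later (ℕP.≤∧≢⇒< k≤a k≢a) (subst (suc a <_) (ℕP.+-suc k (suc m)) 1+a<k+m))

pathEdges-range-unique : ∀ k m → Unique (pathEdges (range k m))
pathEdges-range-unique k zero = AllPairs.[]
pathEdges-range-unique k (suc zero) = AllPairs.[]
pathEdges-range-unique k (suc (suc m)) =
  subst (λ e → Unique (e ∷ pathEdges (range (suc k) (suc m)))) (sym (sortedPair-< (ℕP.n<1+n k)))
    (¬Any⇒All¬ _ (ℕP.<-irrefl refl ∘ proj₁ ∘ ∈-pathEdges-range⁻ (suc k) (suc m)) AllPairs.∷ pathEdges-range-unique (suc k) (suc m))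

cycleEdges : ℕ → List Pair
cycleEdges n = pathEdges (range 0 n) ++ (0 , pred n) ∷ []

cycleEdges≡closedPath : ∀ m → cycleEdges (suc (suc m)) ≡ pathEdges (range 0 (suc (suc m)) ++ 0 ∷ [])
cycleEdges≡closedPath m rewrite pathEdges-range-∷ʳ 0 (suc m) 0 = refl

cycleEdges-unique : ∀ m → Unique (cycleEdges (3 ℕ.+ m))
cycleEdges-unique m = Unique.++⁺ (pathEdges-range-unique 0 (3 ℕ.+ m)) ([] AllPairs.∷ AllPairs.[]) disjoint
  where
  disjoint : ∀ {e} → ¬ (e ∈ pathEdges (range 0 (3 ℕ.+ m)) × e ∈ (0 , suc (suc m)) ∷ [])
  disjoint (e∈ , here refl) with ∈-pathEdges-range⁻ 0 (3 ℕ.+ m) e∈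
  ... | _ , () , _

CycleEdge : ℕ → ℕ → ℕ → Set
CycleEdge n a b = (b ≡ suc a × b < n) ⊎ (a ≡ 0 × b ≡ pred n)

∈-cycleEdges⁻ : ∀ n {a b} → (a , b) ∈ cycleEdges n → CycleEdge n a b
∈-cycleEdges⁻ n ab∈ with ∈-++⁻ (pathEdges (range 0 n)) ab∈
... | inj₁ ab∈′ = let _ , b≡1+a , b<n = ∈-pathEdges-range⁻ 0 n ab∈′ in inj₁ (b≡1+a , b<n)
... | inj₂ (here refl) = inj₂ (refl , refl)

∈-cycleEdges⁺ : ∀ n {a b} → CycleEdge n a b → (a , b) ∈ cycleEdges n
∈-cycleEdges⁺ n (inj₁ (refl , b<n)) = ∈-++⁺ˡ (∈-pathEdges-range⁺ n 0 z≤n b<n)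
∈-cycleEdges⁺ n (inj₂ (refl , refl)) = ∈-++⁺ʳ (pathEdges (range 0 n)) (here refl)

cycleAdjℕ-suc : ∀ n a → T (cycleAdjℕ n a (suc a))
cycleAdjℕ-suc n a rewrite ≡ᵇ-refl a = tt

cycleAdjℕ-wrap : ∀ n → T (cycleAdjℕ (suc n) 0 n)
cycleAdjℕ-wrap n rewrite ≡ᵇ-refl n | Bool.∨-zeroʳ (1 ≡ᵇ n) = tt

≡ᵇ⇒≡ : ∀ {x y} → (x ≡ᵇ y) ≡ true → x ≡ y
≡ᵇ⇒≡ {x} {y} eq = ℕP.≡ᵇ⇒≡ x y (subst T (sym eq) tt)

cycleAdjℕ⇒CycleEdge : ∀ n {a b} → a < b → T (cycleAdjℕ n a b) → b ≡ suc a ⊎ (a ≡ 0 × suc b ≡ n)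
cycleAdjℕ⇒CycleEdge n {a} {b} a<b adj with suc a ≡ᵇ b in 1+a≡b
... | true = inj₁ (sym (≡ᵇ⇒≡ 1+a≡b))
... | false with suc b ≡ᵇ a in 1+b≡a
...   | true = ⊥-elim (ℕP.<-asym a<b (subst (b <_) (≡ᵇ⇒≡ 1+b≡a) (ℕP.n<1+n b)))
...   | false with a ≡ᵇ 0 in a≡0 | suc b ≡ᵇ n in 1+b≡n | b ≡ᵇ 0 in b≡0
...     | true | true | _ = inj₂ (≡ᵇ⇒≡ a≡0 , ≡ᵇ⇒≡ 1+b≡n)
...     | _ | _ | true = ⊥-elim (ℕP.n≮0 (subst (a <_) (≡ᵇ⇒≡ b≡0) a<b))
...     | true | false | false = ⊥-elim adj
...     | false | _ | false = ⊥-elim adj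

∈-edgePairs-cycle⁻ : ∀ n {a b} → (a , b) ∈ edgePairs (cycle n) → a < b × b < n × T (cycleAdjℕ n a b)
∈-edgePairs-cycle⁻ n ab∈ with ∈-map⁻ toPair ab∈
... | (i , j) , ij∈ , refl with Equivalence.to T-∧ (∈-edges⁻ (cycle n) ij∈)
... | i<j , adj = ℕP.<ᵇ⇒< (toℕ i) (toℕ j) i<j , Fin.toℕ<n j , adj

∈-edgePairs-cycle⁺ : ∀ n {a b} → a < b → b < n → T (cycleAdjℕ n a b) → (a , b) ∈ edgePairs (cycle n)
∈-edgePairs-cycle⁺ n {a} {b} a<b b<n adj = subst (_∈ edgePairs (cycle n)) toPair-ij (∈-map⁺ toPair (∈-edges⁺ (cycle n) isEdge))
  where
  a<n = ℕP.<-trans a<b b<n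
  toPair-ij : toPair (fromℕ< a<n , fromℕ< b<n) ≡ (a , b)
  toPair-ij = cong₂ _,_ (Fin.toℕ-fromℕ< a<n) (Fin.toℕ-fromℕ< b<n)
  isEdge : T (isEdgeᵇ (cycle n) (fromℕ< a<n) (fromℕ< b<n))
  isEdge rewrite Fin.toℕ-fromℕ< a<n | Fin.toℕ-fromℕ< b<n with a <ᵇ b | ℕP.<⇒<ᵇ a<b
  ... | true | _ = adj

edgePairs-cycle↭cycleEdges : ∀ m → edgePairs (cycle (3 ℕ.+ m)) ↭ cycleEdges (3 ℕ.+ m)
edgePairs-cycle↭cycleEdges m = Unique∧⊆∧⊇⇒↭ (edgePairs-unique (cycle n)) (cycleEdges-unique m) ⊆ ⊇
  where
  n = 3 ℕ.+ m
  ⊆ : ∀ {e} → e ∈ edgePairs (cycle n) → e ∈ cycleEdges n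
  ⊆ {a , b} ab∈ with ∈-edgePairs-cycle⁻ n ab∈
  ... | a<b , b<n , adj with cycleAdjℕ⇒CycleEdge n a<b adj
  ... | inj₁ b≡1+a = ∈-cycleEdges⁺ n (inj₁ (b≡1+a , b<n))
  ... | inj₂ (a≡0 , 1+b≡n) = ∈-cycleEdges⁺ n (inj₂ (a≡0 , cong pred 1+b≡n))
  ⊇ : ∀ {e} → e ∈ cycleEdges n → e ∈ edgePairs (cycle n)
  ⊇ {a , b} ab∈ with ∈-cycleEdges⁻ n ab∈
  ... | inj₁ (refl , b<n) = ∈-edgePairs-cycle⁺ n (ℕP.n<1+n a) b<n (cycleAdjℕ-suc n a)
  ... | inj₂ (refl , refl) = ∈-edgePairs-cycle⁺ n (s≤s z≤n) (ℕP.n<1+n _) (cycleAdjℕ-wrap (suc (suc m)))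

matchingSum-cycle : ∀ m → matchingSum sgn (edgePairs (cycle (3 ℕ.+ m))) ≡ σ (3 ℕ.+ m) - σ (suc m)
matchingSum-cycle m = begin
  matchingSum sgn (edgePairs (cycle (3 ℕ.+ m))) ≡⟨ matchingSum-↭ sgn (edgePairs-cycle↭cycleEdges m) ⟩
  matchingSum sgn (cycleEdges (3 ℕ.+ m)) ≡⟨ cong (matchingSum sgn) (cycleEdges≡closedPath (suc m)) ⟩
  matchingSum sgn (sortedPair 0 1 ∷ pathEdges xs) ≡⟨ matchingSum-∷ sgn (sortedPair 0 1) (pathEdges xs) ⟩
  matchingSum sgn (pathEdges xs) + matchingSum (sgn ∘ suc) (filterᵇ (disjointℕ (sortedPair 0 1)) (pathEdges xs))
    ≡⟨ cong₂ _+_ (matchingSum-path xs xs-unique) (cong (matchingSum (sgn ∘ suc)) avoiding-01) ⟩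
  σ (length xs) + matchingSum (sgn ∘ suc) (pathEdges R) ≡⟨ cong₂ _+_ (cong σ length-xs) (matchingSum-sgn∘suc (pathEdges R)) ⟩
  σ (3 ℕ.+ m) - matchingSum sgn (pathEdges R)
    ≡⟨ cong (λ s → σ (3 ℕ.+ m) - s) (trans (matchingSum-path R (range-unique 2 (suc m))) (cong σ (length-range 2 (suc m)))) ⟩
  σ (3 ℕ.+ m) - σ (suc m) ∎
  where
  open ≡-Reasoning
  R = range 2 (suc m)
  xs = 1 ∷ R ++ 0 ∷ []
  0∉1∷R : 0 ∉ 1 ∷ R
  0∉1∷R 0∈ with ∈-range⁻ 1 (2 ℕ.+ m) 0∈
  ... | () , _
  1∉R : 1 ∉ R
  1∉R 1∈ with ∈-range⁻ 2 (suc m) 1∈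
  ... | s≤s () , _
  xs-unique : Unique xs
  xs-unique = Unique.++⁺ (range-unique 1 (2 ℕ.+ m)) ([] AllPairs.∷ AllPairs.[]) λ { (0∈ , here refl) → 0∉1∷R 0∈ }
  length-xs : length xs ≡ 3 ℕ.+ m
  length-xs = cong suc (trans (List.length-++ R) (trans (cong (ℕ._+ 1) (length-range 2 (suc m))) (ℕP.+-comm (suc m) 1)))
  avoiding-01 : filterᵇ (disjointℕ (sortedPair 0 1)) (pathEdges xs) ≡ pathEdges R
  avoiding-01 = begin
    filterᵇ (disjointℕ (sortedPair 0 1)) (pathEdges xs) ≡⟨ filterᵇ-cong (disjointℕ-sortedPair 0 1) (pathEdges xs) ⟩
    filterᵇ (λ e → avoids 0 e ∧ avoids 1 e) (pathEdges xs) ≡⟨ filterᵇ-∧ (avoids 0) (avoids 1) (pathEdges xs) ⟩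
    filterᵇ (avoids 1) (filterᵇ (avoids 0) (pathEdges ((1 ∷ R) ++ 0 ∷ [])))
      ≡⟨ cong (filterᵇ (avoids 1)) (filter-avoids-pathEdges-split 0 (1 ∷ R) []) ⟩
    filterᵇ (avoids 1) (filterᵇ (avoids 0) (pathEdges (1 ∷ R)) ++ [])
      ≡⟨ cong (λ L → filterᵇ (avoids 1) (L ++ [])) (filter-avoids-pathEdges (1 ∷ R) 0∉1∷R) ⟩
    filterᵇ (avoids 1) (pathEdges (1 ∷ R) ++ []) ≡⟨ cong (filterᵇ (avoids 1)) (List.++-identityʳ (pathEdges (1 ∷ R))) ⟩
    filterᵇ (avoids 1) (pathEdges ([] ++ 1 ∷ R)) ≡⟨ filter-avoids-pathEdges-split 1 [] R ⟩
    filterᵇ (avoids 1) (pathEdges R) ≡⟨ filter-avoids-pathEdges R 1∉R ⟩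
    pathEdges R ∎

-- The vertices of C_{v+1+k} ∖ v in path order: v+1, …, v+k, 0, …, v-1.
pathAround : ℕ → ℕ → List ℕ
pathAround v k = range (suc v) k ++ range 0 v

pathAround-unique : ∀ v k → Unique (pathAround v k)
pathAround-unique v k = Unique.++⁺ (range-unique (suc v) k) (range-unique 0 v)
  λ (z∈ , z∈') → ℕP.<-asym (proj₂ (∈-range⁻ 0 v z∈')) (proj₁ (∈-range⁻ (suc v) k z∈))

length-pathAround : ∀ v k → length (pathAround v k) ≡ k ℕ.+ v
length-pathAround v k rewrite List.length-++ (range (suc v) k) {range 0 v} | length-range (suc v) k | length-range 0 v = refl

∈-pathAround⁺ : ∀ v k {z} → z < v ℕ.+ suc k → z ≢ v → z ∈ pathAround v k
∈-pathAround⁺ v k {z} z<n z≢v with ℕP.<-cmp z v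
... | tri< z<v _ _ = ∈-++⁺ʳ (range (suc v) k) (∈-range⁺ 0 v z≤n z<v)
... | tri≈ _ z≡v _ = ⊥-elim (z≢v z≡v)
... | tri> _ _ v<z = ∈-++⁺ˡ (∈-range⁺ (suc v) k v<z (subst (z <_) (ℕP.+-suc v k) z<n))

∈-pathAround⁻ : ∀ v k {z} → z ∈ pathAround v k → z < v ℕ.+ suc k × z ≢ v
∈-pathAround⁻ v k {z} z∈ with ∈-++⁻ (range (suc v) k) z∈
... | inj₁ z∈ʳ = let v<z , z<1+v+k = ∈-range⁻ (suc v) k z∈ʳ
                 in subst (z <_) (sym (ℕP.+-suc v k)) z<1+v+k , (λ z≡v → ℕP.<-irrefl (sym z≡v) v<z)
... | inj₂ z∈ˡ = let _ , z<v = ∈-range⁻ 0 v z∈ˡ in ℕP.<-trans z<v (ℕP.m<m+n v (s≤s z≤n)) , (λ z≡v → ℕP.<-irrefl z≡v z<v)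

filter-avoids-cycleEdges : ∀ n v k → v ℕ.+ suc k ≡ suc (suc n) →
  filterᵇ (avoids v) (cycleEdges (suc (suc n))) ↭ pathEdges (pathAround v k)
filter-avoids-cycleEdges n v k v+1+k≡n = ↭.↭-trans (↭.↭-reflexive split) (rotate v refl)
  where
  A = range 0 v
  B = range (suc v) k
  split : filterᵇ (avoids v) (cycleEdges (suc (suc n)))
          ≡ filterᵇ (avoids v) (pathEdges A) ++ filterᵇ (avoids v) (pathEdges (B ++ 0 ∷ []))
  split = begin
    filterᵇ (avoids v) (cycleEdges (suc (suc n))) ≡⟨ cong (filterᵇ (avoids v)) (cycleEdges≡closedPath n) ⟩
    filterᵇ (avoids v) (pathEdges (range 0 (suc (suc n)) ++ 0 ∷ []))
      ≡⟨ cong (λ l → filterᵇ (avoids v) (pathEdges (range 0 l ++ 0 ∷ []))) (sym v+1+k≡n) ⟩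
    filterᵇ (avoids v) (pathEdges (range 0 (v ℕ.+ suc k) ++ 0 ∷ []))
      ≡⟨ cong (λ l → filterᵇ (avoids v) (pathEdges (l ++ 0 ∷ []))) (range-split 0 v k) ⟩
    filterᵇ (avoids v) (pathEdges ((A ++ v ∷ B) ++ 0 ∷ []))
      ≡⟨ cong (filterᵇ (avoids v) ∘ pathEdges) (List.++-assoc A (v ∷ B) (0 ∷ [])) ⟩
    filterᵇ (avoids v) (pathEdges (A ++ v ∷ (B ++ 0 ∷ []))) ≡⟨ filter-avoids-pathEdges-split v A (B ++ 0 ∷ []) ⟩
    filterᵇ (avoids v) (pathEdges A) ++ filterᵇ (avoids v) (pathEdges (B ++ 0 ∷ [])) ∎
    where open ≡-Reasoning
  v∉B : ∀ {w} → w ∉ range (suc w) k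
  v∉B {w} w∈ = ℕP.<-irrefl refl (proj₁ (∈-range⁻ (suc w) k w∈))
  rotate : ∀ w → w ≡ v →
    filterᵇ (avoids v) (pathEdges A) ++ filterᵇ (avoids v) (pathEdges (B ++ 0 ∷ [])) ↭ pathEdges (pathAround v k)
  rotate zero refl = ↭.↭-reflexive (begin
    filterᵇ (avoids 0) (pathEdges (B ++ 0 ∷ [])) ≡⟨ filter-avoids-pathEdges-split 0 B [] ⟩
    filterᵇ (avoids 0) (pathEdges B) ++ [] ≡⟨ cong (_++ []) (filter-avoids-pathEdges B v∉B) ⟩
    pathEdges B ++ [] ≡⟨ List.++-identityʳ (pathEdges B) ⟩
    pathEdges B ≡⟨ cong pathEdges (sym (List.++-identityʳ B)) ⟩
    pathEdges (B ++ []) ∎)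
    where open ≡-Reasoning
  rotate (suc w) refl =
    ↭.↭-trans (↭.↭-reflexive (cong₂ _++_ (filter-avoids-pathEdges A v∉A) (filter-avoids-pathEdges (B ++ 0 ∷ []) v∉B++0)))
    (↭.↭-trans (↭.++-comm (pathEdges A) (pathEdges (B ++ 0 ∷ [])))
               (↭.↭-reflexive (sym (pathEdges-++ B 0 (range 1 w)))))
    where
    v∉A : v ∉ A
    v∉A v∈ = ℕP.<-irrefl refl (proj₂ (∈-range⁻ 0 v v∈))
    v∉B++0 : v ∉ B ++ 0 ∷ []
    v∉B++0 v∈ with ∈-++⁻ B v∈
    ... | inj₁ v∈B = v∉B v∈B
    ... | inj₂ (here ())

Unique-++-∷⁻ : ∀ {A : Set} (C : List A) {w} D → Unique (C ++ w ∷ D) →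
  Unique C × w ∉ C × w ∉ D × Unique D × (∀ {v} → v ∈ C → v ∉ D)
Unique-++-∷⁻ [] D u@(_ AllPairs.∷ u') = AllPairs.[] , (λ ()) , Unique.Unique[x∷xs]⇒x∉xs u , u' , (λ ())
Unique-++-∷⁻ (c ∷ C) {w} D u@(_ AllPairs.∷ u') with Unique-++-∷⁻ C D u'
... | C-unique , w∉C , w∉D , D-unique , C#D =
  ¬Any⇒All¬ C (c∉ ∘ ∈-++⁺ˡ) AllPairs.∷ C-unique ,
  (λ { (here refl) → c∉ (∈-++⁺ʳ C (here refl)) ; (there w∈C) → w∉C w∈C }) ,
  w∉D , D-unique ,
  (λ { (here refl) v∈D → c∉ (∈-++⁺ʳ C (there v∈D)) ; (there v∈C) → C#D v∈C })
  where
  c∉ = Unique.Unique[x∷xs]⇒x∉xs u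

-- Deleting an inner vertex w of a path leaves two disjoint paths, whose values multiply.
matchingSum-path∖ : ∀ C w D → Unique (C ++ w ∷ D) →
  matchingSum sgn (filterᵇ (avoids w) (pathEdges (C ++ w ∷ D))) ≡ σ (length C) * σ (length D)
matchingSum-path∖ C w D u with Unique-++-∷⁻ C D u
... | C-unique , w∉C , w∉D , D-unique , C#D = begin
  matchingSum sgn (filterᵇ (avoids w) (pathEdges (C ++ w ∷ D))) ≡⟨ cong (matchingSum sgn) (filter-avoids-pathEdges-split w C D) ⟩
  matchingSum sgn (filterᵇ (avoids w) (pathEdges C) ++ filterᵇ (avoids w) (pathEdges D))
    ≡⟨ cong (matchingSum sgn) (cong₂ _++_ (filter-avoids-pathEdges C w∉C) (filter-avoids-pathEdges D w∉D)) ⟩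
  matchingSum sgn (pathEdges C ++ pathEdges D) ≡⟨ matchingSum-path-++ C C-unique (pathEdges D) (pathEdges-avoids D ∘ C#D) ⟩
  σ (length C) * matchingSum sgn (pathEdges D) ≡⟨ cong (σ (length C) *_) (matchingSum-path D D-unique) ⟩
  σ (length C) * σ (length D) ∎
  where open ≡-Reasoning

verticesAfter : ∀ m → Fin (3 ℕ.+ m) → ℕ
verticesAfter m v = 3 ℕ.+ m ∸ suc (toℕ v)

toℕ+verticesAfter : ∀ m (v : Fin (3 ℕ.+ m)) → toℕ v ℕ.+ suc (verticesAfter m v) ≡ 3 ℕ.+ m
toℕ+verticesAfter m v = trans (ℕP.+-suc (toℕ v) (verticesAfter m v)) (ℕP.m+[n∸m]≡n (Fin.toℕ<n v))

cycle∖path : ∀ m → Fin (3 ℕ.+ m) → List ℕ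
cycle∖path m v = pathAround (toℕ v) (verticesAfter m v)

cycle∖path-unique : ∀ m v → Unique (cycle∖path m v)
cycle∖path-unique m v = pathAround-unique (toℕ v) (verticesAfter m v)

length-cycle∖path : ∀ m v → length (cycle∖path m v) ≡ 2 ℕ.+ m
length-cycle∖path m v = trans (length-pathAround (toℕ v) (verticesAfter m v))
  (trans (ℕP.+-comm (verticesAfter m v) (toℕ v))
         (ℕP.suc-injective (trans (sym (ℕP.+-suc (toℕ v) (verticesAfter m v))) (toℕ+verticesAfter m v))))

filter-avoids-cycleEdges-vertex : ∀ m v → filterᵇ (avoids (toℕ v)) (cycleEdges (3 ℕ.+ m)) ↭ pathEdges (cycle∖path m v)
filter-avoids-cycleEdges-vertex m v = filter-avoids-cycleEdges (suc m) (toℕ v) (verticesAfter m v) (toℕ+verticesAfter m v)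

matchingSum-cycle∖ : ∀ F m v → matchingSum F (edgePairs (cycle (3 ℕ.+ m) ∖ v)) ≡ matchingSum F (pathEdges (cycle∖path m v))
matchingSum-cycle∖ F m v = begin
  matchingSum F (edgePairs (cycle (3 ℕ.+ m) ∖ v)) ≡⟨ matchingSum-∖ F (cycle (3 ℕ.+ m)) v ⟩
  matchingSum F (filterᵇ (avoids (toℕ v)) (edgePairs (cycle (3 ℕ.+ m))))
    ≡⟨ matchingSum-↭ F (↭.filter-↭ (T? ∘ avoids (toℕ v)) (edgePairs-cycle↭cycleEdges m)) ⟩
  matchingSum F (filterᵇ (avoids (toℕ v)) (cycleEdges (3 ℕ.+ m))) ≡⟨ matchingSum-↭ F (filter-avoids-cycleEdges-vertex m v) ⟩
  matchingSum F (pathEdges (cycle∖path m v)) ∎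
  where open ≡-Reasoning

matchingSum-cycle∖∖ : ∀ F m v x → matchingSum F (edgePairs ((cycle (3 ℕ.+ m) ∖ v) ∖ x))
  ≡ matchingSum F (filterᵇ (avoids (toℕ (punchIn v x))) (pathEdges (cycle∖path m v)))
matchingSum-cycle∖∖ F m v x = begin
  matchingSum F (edgePairs ((cycle (3 ℕ.+ m) ∖ v) ∖ x)) ≡⟨ matchingSum-∖∖ F (cycle (3 ℕ.+ m)) v x ⟩
  matchingSum F (filterᵇ (avoids w) (filterᵇ (avoids (toℕ v)) (edgePairs (cycle (3 ℕ.+ m)))))
    ≡⟨ matchingSum-↭ F (↭.filter-↭ (T? ∘ avoids w) (↭.filter-↭ (T? ∘ avoids (toℕ v)) (edgePairs-cycle↭cycleEdges m))) ⟩
  matchingSum F (filterᵇ (avoids w) (filterᵇ (avoids (toℕ v)) (cycleEdges (3 ℕ.+ m))))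
    ≡⟨ matchingSum-↭ F (↭.filter-↭ (T? ∘ avoids w) (filter-avoids-cycleEdges-vertex m v)) ⟩
  matchingSum F (filterᵇ (avoids w) (pathEdges (cycle∖path m v))) ∎
  where
  open ≡-Reasoning
  w = toℕ (punchIn v x)

∈-pathEdges-consecutive : ∀ C z w D → sortedPair z w ∈ pathEdges (C ++ z ∷ w ∷ D)
∈-pathEdges-consecutive [] z w D = here refl
∈-pathEdges-consecutive (c ∷ []) z w D = there (here refl)
∈-pathEdges-consecutive (c ∷ c' ∷ C) z w D = there (∈-pathEdges-consecutive (c' ∷ C) z w D)

cycleAdjℕ-sym : ∀ n a b → cycleAdjℕ n a b ≡ cycleAdjℕ n b a
cycleAdjℕ-sym n a b = ∨-swap (suc a ≡ᵇ b) (suc b ≡ᵇ a) ((a ≡ᵇ 0) ∧ (suc b ≡ᵇ n)) ((b ≡ᵇ 0) ∧ (suc a ≡ᵇ n))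
  where
  ∨-swap : ∀ p q r s → (p ∨ q ∨ r ∨ s) ≡ (q ∨ p ∨ s ∨ r)
  ∨-swap true true r s = refl
  ∨-swap true false r s = refl
  ∨-swap false true r s = refl
  ∨-swap false false r s = ∨-comm r s

cycle∖path-adjacent : ∀ m v C z w D → cycle∖path m v ≡ C ++ z ∷ w ∷ D → T (cycleAdjℕ (3 ℕ.+ m) w z)
cycle∖path-adjacent m v C z w D eq = adjacent (sortedPair-cases z w)
  where
  n = 3 ℕ.+ m
  sortedPair-cases : ∀ z w → sortedPair z w ≡ (z , w) ⊎ sortedPair z w ≡ (w , z)
  sortedPair-cases z w with z <ᵇ w
  ... | true = inj₁ refl
  ... | false = inj₂ refl
  zw∈ : sortedPair z w ∈ edgePairs (cycle n)
  zw∈ = ↭.∈-resp-↭ (↭.↭-sym (edgePairs-cycle↭cycleEdges m))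
          (proj₁ (∈-filter⁻ (T? ∘ avoids (toℕ v))
            (↭.∈-resp-↭ (↭.↭-sym (filter-avoids-cycleEdges-vertex m v))
              (subst (λ Y → sortedPair z w ∈ pathEdges Y) (sym eq) (∈-pathEdges-consecutive C z w D)))))
  adjacent : sortedPair z w ≡ (z , w) ⊎ sortedPair z w ≡ (w , z) → T (cycleAdjℕ n w z)
  adjacent (inj₁ eq) = subst T (cycleAdjℕ-sym n z w) (proj₂ (proj₂ (∈-edgePairs-cycle⁻ n (subst (_∈ edgePairs (cycle n)) eq zw∈))))
  adjacent (inj₂ eq) = proj₂ (proj₂ (∈-edgePairs-cycle⁻ n (subst (_∈ edgePairs (cycle n)) eq zw∈)))

-- σ and τ modulo 3

Mod3 : ℕ → Set
Mod3 k = ∃ λ j → k ≡ j ℕ.* 3 ⊎ k ≡ suc (j ℕ.* 3) ⊎ k ≡ suc (suc (j ℕ.* 3))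

mod3 : ∀ k → Mod3 k
mod3 zero = 0 , inj₁ refl
mod3 (suc k) with mod3 k
... | j , inj₁ refl = j , inj₂ (inj₁ refl)
... | j , inj₂ (inj₁ refl) = j , inj₂ (inj₂ refl)
... | j , inj₂ (inj₂ refl) = suc j , inj₁ refl

residue-unique : ∀ {a b} x y → a < 3 → b < 3 → a ℕ.+ x ℕ.* 3 ≡ b ℕ.+ y ℕ.* 3 → a ≡ b
residue-unique {a} {b} zero zero _ _ eq = trans (sym (ℕP.+-identityʳ a)) (trans eq (ℕP.+-identityʳ b))
residue-unique {a} {b} zero (suc y) a<3 _ eq =
  ⊥-elim (ℕP.<-irrefl refl (ℕP.<-≤-trans a<3 (subst (3 ℕ.≤_) (trans (sym eq) (ℕP.+-identityʳ a))
                                                      (ℕP.≤-trans (ℕP.m≤m+n 3 (y ℕ.* 3)) (ℕP.m≤n+m _ b)))))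
residue-unique {a} {b} (suc x) zero _ b<3 eq =
  ⊥-elim (ℕP.<-irrefl refl (ℕP.<-≤-trans b<3 (subst (3 ℕ.≤_) (trans eq (ℕP.+-identityʳ b))
                                                      (ℕP.≤-trans (ℕP.m≤m+n 3 (x ℕ.* 3)) (ℕP.m≤n+m _ a)))))
residue-unique {a} {b} (suc x) (suc y) a<3 b<3 eq =
  residue-unique x y a<3 b<3 (ℕP.+-cancelˡ-≡ 3 _ _ (trans (sym (shift a x)) (trans eq (shift b y))))
  where
  shift : ∀ a x → a ℕ.+ (3 ℕ.+ x ℕ.* 3) ≡ 3 ℕ.+ (a ℕ.+ x ℕ.* 3)
  shift = ℕ-Solver.solve-∀

PlusMinusOne : ℤ → Set
PlusMinusOne e = e ≡ + 1 ⊎ e ≡ - + 1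

σ-after-equal : ∀ k {e} → σ k ≡ e → σ (suc k) ≡ e → σ (suc (suc k)) ≡ + 0
σ-after-equal k {e} σ₀ σ₁ = trans (cong₂ _-_ σ₁ σ₀) (ℤP.+-inverseʳ e)

τ-after : ∀ j {e} → σ (j ℕ.* 3) ≡ e → τ (j ℕ.* 3) ≡ (+ j + + j) * e → τ (suc (j ℕ.* 3)) ≡ + j * e →
  τ (suc (suc (j ℕ.* 3))) ≡ - ((+ 1 + + j) * e)
τ-after j {e} σ₀ τ₀ τ₁ =
  trans (cong₂ (λ a b → a - b - σ (j ℕ.* 3)) τ₁ τ₀) (trans (cong (λ s → + j * e - (+ j + + j) * e - s) σ₀) (step e (+ j)))
  where
  step : ∀ e J → J * e - (J + J) * e - e ≡ - ((+ 1 + J) * e)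
  step = solve-∀

-- σ has period 6 with values 1, 1, 0, -1, -1, 0; τ grows linearly in between.
σ-τ-period : ∀ j → ∃ λ e → PlusMinusOne e × σ (j ℕ.* 3) ≡ e × σ (suc (j ℕ.* 3)) ≡ e ×
                           τ (j ℕ.* 3) ≡ (+ j + + j) * e × τ (suc (j ℕ.* 3)) ≡ + j * e
σ-τ-period zero = + 1 , inj₁ refl , refl , refl , refl , refl
σ-τ-period (suc j) with σ-τ-period j
... | e , ±1 , σ₀ , σ₁ , τ₀ , τ₁ = - e , flip ±1 , σ₃ , σ₄ , τ₃ , τ₄
  where
  x = j ℕ.* 3
  flip : ∀ {e} → PlusMinusOne e → PlusMinusOne (- e)
  flip (inj₁ refl) = inj₂ refl
  flip (inj₂ refl) = inj₁ refl
  σ₂ : σ (suc (suc x)) ≡ + 0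
  σ₂ = σ-after-equal x σ₀ σ₁
  σ₃ : σ (suc (suc (suc x))) ≡ - e
  σ₃ = trans (cong₂ _-_ σ₂ σ₁) (ℤP.+-identityˡ (- e))
  σ₄ : σ (suc (suc (suc (suc x)))) ≡ - e
  σ₄ = trans (cong₂ _-_ σ₃ σ₂) (ℤP.+-identityʳ (- e))
  τ₂ : τ (suc (suc x)) ≡ - ((+ 1 + + j) * e)
  τ₂ = τ-after j σ₀ τ₀ τ₁
  τ₃ : τ (suc (suc (suc x))) ≡ ((+ 1 + + j) + (+ 1 + + j)) * - e
  τ₃ = trans (cong₂ (λ a b → a - b - σ (suc x)) τ₂ τ₁) (trans (cong (λ s → - ((+ 1 + + j) * e) - + j * e - s) σ₁) (step e (+ j)))
    where
    step : ∀ e J → - ((+ 1 + J) * e) - J * e - e ≡ ((+ 1 + J) + (+ 1 + J)) * - e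
    step = solve-∀
  τ₄ : τ (suc (suc (suc (suc x)))) ≡ (+ 1 + + j) * - e
  τ₄ = trans (cong₂ (λ a b → a - b - σ (suc (suc x))) τ₃ τ₂)
             (trans (cong (λ s → ((+ 1 + + j) + (+ 1 + + j)) * - e - - ((+ 1 + + j) * e) - s) σ₂) (step e (+ j)))
    where
    step : ∀ e J → ((+ 1 + J) + (+ 1 + J)) * - e - - ((+ 1 + J) * e) - + 0 ≡ (+ 1 + J) * - e
    step = solve-∀

PlusMinusOne⇒≢0 : ∀ {e} → PlusMinusOne e → e ≢ + 0
PlusMinusOne⇒≢0 (inj₁ refl) ()
PlusMinusOne⇒≢0 (inj₂ refl) ()

σ[3j]≢0 : ∀ j → σ (j ℕ.* 3) ≢ + 0
σ[3j]≢0 j with σ-τ-period j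
... | e , ±1 , σ₀ , _ = PlusMinusOne⇒≢0 ±1 ∘ trans (sym σ₀)

σ[3j+1]≢0 : ∀ j → σ (suc (j ℕ.* 3)) ≢ + 0
σ[3j+1]≢0 j with σ-τ-period j
... | e , ±1 , _ , σ₁ , _ = PlusMinusOne⇒≢0 ±1 ∘ trans (sym σ₁)

σ[3j+2]≡0 : ∀ j → σ (suc (suc (j ℕ.* 3))) ≡ + 0
σ[3j+2]≡0 j with σ-τ-period j
... | e , _ , σ₀ , σ₁ , _ = σ-after-equal (j ℕ.* 3) σ₀ σ₁

τ[3j+2]≢0 : ∀ j → τ (suc (suc (j ℕ.* 3))) ≢ + 0
τ[3j+2]≢0 j with σ-τ-period j
... | e , ±1 , σ₀ , σ₁ , τ₀ , τ₁ = nonzero ±1 ∘ trans (sym (τ-after j σ₀ τ₀ τ₁))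
  where
  nonzero : PlusMinusOne e → - ((+ 1 + + j) * e) ≢ + 0
  nonzero (inj₁ refl) = λ ()
  nonzero (inj₂ refl) = λ ()

σ[3j+3]-σ[3j+1]≢0 : ∀ j → σ (3 ℕ.+ j ℕ.* 3) - σ (suc (j ℕ.* 3)) ≢ + 0
σ[3j+3]-σ[3j+1]≢0 j with σ-τ-period j
... | e , ±1 , σ₀ , σ₁ , _ = PlusMinusOne⇒≢0 ±1 ∘ cancel
  where
  σ₃ : σ (3 ℕ.+ j ℕ.* 3) ≡ - e
  σ₃ = trans (cong₂ _-_ (σ-after-equal (j ℕ.* 3) σ₀ σ₁) σ₁) (ℤP.+-identityˡ (- e))
  cancel : σ (3 ℕ.+ j ℕ.* 3) - σ (suc (j ℕ.* 3)) ≡ + 0 → e ≡ + 0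
  cancel eq = ℤP.*-cancelˡ-≡ (- + 2) e (+ 0) (trans (sym (trans (cong₂ _-_ σ₃ σ₁) (double e))) (trans eq (sym (ℤP.*-zeroʳ (- + 2)))))
    where
    double : ∀ e → - e - e ≡ - + 2 * e
    double = solve-∀

NotTwoMod3 : ℕ → Set
NotTwoMod3 k = ∀ i → k ≢ suc (suc (i ℕ.* 3))

zero-NotTwoMod3 : ∀ j → NotTwoMod3 (j ℕ.* 3)
zero-NotTwoMod3 j i eq with residue-unique {0} {2} j i (s≤s z≤n) (s≤s (s≤s (s≤s z≤n))) eq
... | ()

one-NotTwoMod3 : ∀ j → NotTwoMod3 (suc (j ℕ.* 3))
one-NotTwoMod3 j i eq with residue-unique {1} {2} j i (s≤s (s≤s z≤n)) (s≤s (s≤s (s≤s z≤n))) eq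
... | ()

σ≢0 : ∀ k → NotTwoMod3 k → σ k ≢ + 0
σ≢0 k k≢2 with mod3 k
... | j , inj₁ refl = σ[3j]≢0 j
... | j , inj₂ (inj₁ refl) = σ[3j+1]≢0 j
... | j , inj₂ (inj₂ refl) = ⊥-elim (k≢2 j refl)

NotTwoMod3-complement : ∀ j {c d} → c ℕ.+ d ≡ suc (j ℕ.* 3) → NotTwoMod3 c → NotTwoMod3 d
NotTwoMod3-complement j {c} c+d≡1 c≢2 i refl with mod3 c
... | a , inj₁ refl = 2≢1 (residue-unique (a ℕ.+ i) j (s≤s (s≤s (s≤s z≤n))) (s≤s (s≤s z≤n)) (trans (shift a i) c+d≡1))
  where
  2≢1 : 2 ≢ 1
  2≢1 ()
  shift : ∀ a i → 2 ℕ.+ (a ℕ.+ i) ℕ.* 3 ≡ a ℕ.* 3 ℕ.+ suc (suc (i ℕ.* 3))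
  shift = ℕ-Solver.solve-∀
... | a , inj₂ (inj₁ refl) = 0≢1 (residue-unique (suc (a ℕ.+ i)) j (s≤s z≤n) (s≤s (s≤s z≤n)) (trans (shift a i) c+d≡1))
  where
  0≢1 : 0 ≢ 1
  0≢1 ()
  shift : ∀ a i → 0 ℕ.+ suc (a ℕ.+ i) ℕ.* 3 ≡ suc (a ℕ.* 3) ℕ.+ suc (suc (i ℕ.* 3))
  shift = ℕ-Solver.solve-∀
... | a , inj₂ (inj₂ refl) = c≢2 a refl

σ*σ≢0 : ∀ j c d → c ℕ.+ d ≡ suc (j ℕ.* 3) → NotTwoMod3 c → σ c * σ d ≢ + 0
σ*σ≢0 j c d c+d≡1 c≢2 σcσd≡0 with ℤP.i*j≡0⇒i≡0∨j≡0 (σ c) σcσd≡0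
... | inj₁ σc≡0 = σ≢0 c c≢2 σc≡0
... | inj₂ σd≡0 = σ≢0 d (NotTwoMod3-complement j c+d≡1 c≢2) σd≡0

-- 1-elementary cycles

μ-cycle∖-at-1 : ∀ m v → matchingSum sgn (edgePairs (cycle (3 ℕ.+ m) ∖ v)) ≡ σ (2 ℕ.+ m)
μ-cycle∖-at-1 m v = trans (matchingSum-cycle∖ sgn m v)
  (trans (matchingSum-path (cycle∖path m v) (cycle∖path-unique m v)) (cong σ (length-cycle∖path m v)))

μ′-cycle∖-at-1 : ∀ m v → matchingSum (signedAffine (+ (2 ℕ.+ m)) (- + 2)) (edgePairs (cycle (3 ℕ.+ m) ∖ v))
  ≡ + (2 ℕ.+ m) * σ (2 ℕ.+ m) + - + 2 * τ (2 ℕ.+ m)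
μ′-cycle∖-at-1 m v = trans (matchingSum-cycle∖ (signedAffine (+ (2 ℕ.+ m)) (- + 2)) m v)
  (trans (matchingSum-path-signedAffine (cycle∖path m v) (cycle∖path-unique m v) (+ (2 ℕ.+ m)) (- + 2))
         (cong (λ k → + (2 ℕ.+ m) * σ k + - + 2 * τ k) (length-cycle∖path m v)))

μ-cycle∖∖-at-1 : ∀ m v x C D → cycle∖path m v ≡ C ++ toℕ (punchIn v x) ∷ D →
  matchingSum sgn (edgePairs ((cycle (3 ℕ.+ m) ∖ v) ∖ x)) ≡ σ (length C) * σ (length D)
μ-cycle∖∖-at-1 m v x C D eq = trans (matchingSum-cycle∖∖ sgn m v x)
  (trans (cong (λ Y → matchingSum sgn (filterᵇ (avoids (toℕ (punchIn v x))) (pathEdges Y))) eq)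
         (matchingSum-path∖ C (toℕ (punchIn v x)) D (subst Unique eq (cycle∖path-unique m v))))

cycle∖path-split : ∀ m v u → ∃₂ λ C D → cycle∖path m v ≡ C ++ toℕ (punchIn v u) ∷ D
cycle∖path-split m v u = ∈-∃++ w∈
  where
  w∈ : toℕ (punchIn v u) ∈ cycle∖path m v
  w∈ = ∈-pathAround⁺ (toℕ v) (verticesAfter m v)
         (subst (toℕ (punchIn v u) <_) (sym (toℕ+verticesAfter m v)) (Fin.toℕ<n (punchIn v u)))
         (Fin.punchInᵢ≢i v u ∘ Fin.toℕ-injective)

cycle∖path-label : ∀ m v {z} → z ∈ cycle∖path m v → ∃ λ x → toℕ (punchIn v x) ≡ z
cycle∖path-label m v {z} z∈ = punchOut v≢z , trans (cong toℕ (Fin.punchIn-punchOut v≢z)) (Fin.toℕ-fromℕ< z<n)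
  where
  z<n : z < 3 ℕ.+ m
  z<n = subst (z <_) (toℕ+verticesAfter m v) (proj₁ (∈-pathAround⁻ (toℕ v) (verticesAfter m v) z∈))
  v≢z : v ≢ fromℕ< z<n
  v≢z v≡z = proj₂ (∈-pathAround⁻ (toℕ v) (verticesAfter m v) z∈) (trans (sym (Fin.toℕ-fromℕ< z<n)) (cong toℕ (sym v≡z)))

cycle∖-not-positive : ∀ m v → σ (2 ℕ.+ m) ≢ + 0 → ¬ Positive (+ 1) (cycle (3 ℕ.+ m)) v
cycle∖-not-positive m v σ[2+m]≢0 positive =
  ℕP.0≢1+n (trans (sym (mult-1≡0 (cycle (3 ℕ.+ m) ∖ v) (σ[2+m]≢0 ∘ trans (sym (μ-cycle∖-at-1 m v))))) positive)

elementary⇒3∣ : ∀ m → Elementary (+ 1) (cycle (3 ℕ.+ m)) → ∃ λ j → m ≡ j ℕ.* 3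
elementary⇒3∣ m ((_ , positive) , _) = from-residue (mod3 m)
  where
  -- A helper rather than `with mod3 m`: with-abstraction would normalise the type of positive, i.e. run mult.
  from-residue : Mod3 m → ∃ λ j → m ≡ j ℕ.* 3
  from-residue (j , inj₁ m≡3j) = j , m≡3j
  from-residue (j , inj₂ (inj₁ m≡3j+1)) =
    ⊥-elim (cycle∖-not-positive m fzero (subst (λ k → σ (2 ℕ.+ k) ≢ + 0) (sym m≡3j+1) (σ[3j]≢0 (suc j))) (positive fzero))
  from-residue (j , inj₂ (inj₂ m≡3j+2)) =
    ⊥-elim (cycle∖-not-positive m fzero (subst (λ k → σ (2 ℕ.+ k) ≢ + 0) (sym m≡3j+2) (σ[3j+1]≢0 (suc j))) (positive fzero))

mult-cycle≡0 : ∀ j → mult (+ 1) (cycle (3 ℕ.+ j ℕ.* 3)) ≡ 0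
mult-cycle≡0 j = mult-1≡0 (cycle (3 ℕ.+ j ℕ.* 3)) (σ[3j+3]-σ[3j+1]≢0 j ∘ trans (sym (matchingSum-cycle (j ℕ.* 3))))

mult-cycle∖≡1 : ∀ j v → mult (+ 1) (cycle (3 ℕ.+ j ℕ.* 3) ∖ v) ≡ 1
mult-cycle∖≡1 j v = mult-1≡1 (cycle (3 ℕ.+ j ℕ.* 3) ∖ v)
  (trans (μ-cycle∖-at-1 m v) (σ[3j+2]≡0 j)) (τ[3j+2]≢0 j ∘ τ≡0 ∘ trans (sym (μ′-cycle∖-at-1 m v)))
  where
  m = j ℕ.* 3
  τ≡0 : + (2 ℕ.+ m) * σ (2 ℕ.+ m) + - + 2 * τ (2 ℕ.+ m) ≡ + 0 → τ (2 ℕ.+ m) ≡ + 0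
  τ≡0 eq rewrite σ[3j+2]≡0 j = ℤP.*-cancelˡ-≡ (- + 2) (τ (2 ℕ.+ m)) (+ 0)
    (trans (sym (trans (cong (_+ - + 2 * τ (2 ℕ.+ m)) (ℤP.*-zeroʳ (+ (2 ℕ.+ m)))) (ℤP.+-identityˡ _)))
           (trans eq (sym (ℤP.*-zeroʳ (- + 2)))))

mult-cycle∖∖≡0 : ∀ j v x C D → cycle∖path (j ℕ.* 3) v ≡ C ++ toℕ (punchIn v x) ∷ D → NotTwoMod3 (length C) →
  mult (+ 1) ((cycle (3 ℕ.+ j ℕ.* 3) ∖ v) ∖ x) ≡ 0
mult-cycle∖∖≡0 j v x C D eq C≢2 =
  mult-1≡0 ((cycle (3 ℕ.+ j ℕ.* 3) ∖ v) ∖ x)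
    (σ*σ≢0 j (length C) (length D) lengths C≢2 ∘ trans (sym (μ-cycle∖∖-at-1 (j ℕ.* 3) v x C D eq)))
  where
  lengths : length C ℕ.+ length D ≡ suc (j ℕ.* 3)
  lengths = ℕP.suc-injective (begin
    suc (length C ℕ.+ length D) ≡⟨ sym (ℕP.+-suc (length C) (length D)) ⟩
    length C ℕ.+ length (toℕ (punchIn v x) ∷ D) ≡⟨ sym (List.length-++ C) ⟩
    length (C ++ toℕ (punchIn v x) ∷ D) ≡⟨ cong length (sym eq) ⟩
    length (cycle∖path (j ℕ.* 3) v) ≡⟨ length-cycle∖path (j ℕ.* 3) v ⟩
    2 ℕ.+ j ℕ.* 3 ∎)
    where open ≡-Reasoning

∷ʳ-split : ∀ {A : Set} (C : List A) {k} → length C ≡ suc k → ∃₂ λ C' z → C ≡ C' ++ z ∷ [] × length C' ≡ k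
∷ʳ-split C length≡ with initLast C
∷ʳ-split .[] () | []
∷ʳ-split .(C' ++ z ∷ []) length≡ | C' ∷ʳ′ z =
  C' , z , refl , ℕP.suc-injective (trans (trans (ℕP.+-comm 1 (length C')) (sym (List.length-++ C'))) length≡)

-- A positive vertex u cuts the path C_n ∖ v at a position ≡ 2 (mod 3); then its predecessor cuts it at a
-- position ≡ 1 (mod 3), so deleting the predecessor removes the root 1 and u is special.
positive-position : ∀ j v u C D → cycle∖path (j ℕ.* 3) v ≡ C ++ toℕ (punchIn v u) ∷ D →
  mult (+ 1) ((cycle (3 ℕ.+ j ℕ.* 3) ∖ v) ∖ u) ≡ 2 → ∃ λ i → length C ≡ suc (suc (i ℕ.* 3))
positive-position j v u C D eq mult≡2 = by-residue (mod3 (length C))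
  where
  not-two : NotTwoMod3 (length C) → ⊥
  not-two C≢2 = ℕP.0≢1+n (trans (sym (mult-cycle∖∖≡0 j v u C D eq C≢2)) mult≡2)
  by-residue : Mod3 (length C) → ∃ λ i → length C ≡ suc (suc (i ℕ.* 3))
  by-residue (i , inj₁ C≡3i) = ⊥-elim (not-two (subst NotTwoMod3 (sym C≡3i) (zero-NotTwoMod3 i)))
  by-residue (i , inj₂ (inj₁ C≡3i+1)) = ⊥-elim (not-two (subst NotTwoMod3 (sym C≡3i+1) (one-NotTwoMod3 i)))
  by-residue (i , inj₂ (inj₂ C≡3i+2)) = i , C≡3i+2

predecessor-essential : ∀ j v u i C' z D → cycle∖path (j ℕ.* 3) v ≡ C' ++ z ∷ toℕ (punchIn v u) ∷ D →
  length C' ≡ suc (i ℕ.* 3) →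
  ∃ λ x → Adj (cycle (3 ℕ.+ j ℕ.* 3) ∖ v) u x × Essential (+ 1) (cycle (3 ℕ.+ j ℕ.* 3) ∖ v) x
predecessor-essential j v u i C' z D eq C'≡3i+1 = x , adjacent , essential
  where
  m = j ℕ.* 3
  w = toℕ (punchIn v u)
  label = cycle∖path-label m v (subst (z ∈_) (sym eq) (∈-++⁺ʳ C' (here refl)))
  x = proj₁ label
  x↦z : toℕ (punchIn v x) ≡ z
  x↦z = proj₂ label
  adjacent : T (cycleAdjℕ (3 ℕ.+ m) w (toℕ (punchIn v x)))
  adjacent = subst (T ∘ cycleAdjℕ (3 ℕ.+ m) w) (sym x↦z) (cycle∖path-adjacent m v C' z w D eq)
  essential : suc (mult (+ 1) ((cycle (3 ℕ.+ m) ∖ v) ∖ x)) ≡ mult (+ 1) (cycle (3 ℕ.+ m) ∖ v)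
  essential = trans (cong suc (mult-cycle∖∖≡0 j v x C' (w ∷ D) eq′ (subst NotTwoMod3 (sym C'≡3i+1) (one-NotTwoMod3 i))))
                    (sym (mult-cycle∖≡1 j v))
    where
    eq′ : cycle∖path m v ≡ C' ++ toℕ (punchIn v x) ∷ w ∷ D
    eq′ = subst (λ y → cycle∖path m v ≡ C' ++ y ∷ w ∷ D) (sym x↦z) eq

positive⇒special : ∀ j v u → Positive (+ 1) (cycle (3 ℕ.+ j ℕ.* 3) ∖ v) u → Special (+ 1) (cycle (3 ℕ.+ j ℕ.* 3) ∖ v) u
positive⇒special j v u positive = not-essential , predecessor-essential j v u i C' z D eq′ C'≡3i+1
  where
  mult≡2 : mult (+ 1) ((cycle (3 ℕ.+ j ℕ.* 3) ∖ v) ∖ u) ≡ 2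
  mult≡2 = trans positive (cong suc (mult-cycle∖≡1 j v))
  not-essential : ¬ Essential (+ 1) (cycle (3 ℕ.+ j ℕ.* 3) ∖ v) u
  not-essential essential = ℕP.1+n≢0 (ℕP.suc-injective (trans (cong suc (sym mult≡2)) (trans essential (mult-cycle∖≡1 j v))))
  split = cycle∖path-split (j ℕ.* 3) v u
  C = proj₁ split
  D = proj₁ (proj₂ split)
  eq = proj₂ (proj₂ split)
  position = positive-position j v u C D eq mult≡2
  i = proj₁ position
  last = ∷ʳ-split C (proj₂ position)
  C' = proj₁ last
  z = proj₁ (proj₂ last)
  C'≡3i+1 = proj₂ (proj₂ (proj₂ last))
  eq′ : cycle∖path (j ℕ.* 3) v ≡ C' ++ z ∷ toℕ (punchIn v u) ∷ D
  eq′ = trans eq (trans (cong (_++ toℕ (punchIn v u) ∷ D) (proj₁ (proj₂ (proj₂ last))))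
                        (List.++-assoc C' (z ∷ []) (toℕ (punchIn v u) ∷ D)))

cycle-elementary : ∀ j → Elementary (+ 1) (cycle (3 ℕ.+ j ℕ.* 3))
cycle-elementary j = (mult-cycle≡0 j , λ v → trans (mult-cycle∖≡1 j v) (cong suc (sym (mult-cycle≡0 j))))
                   , λ v (u , positive , not-special) → not-special (positive⇒special j v u positive)

theorem4p4 : (n : ℕ) → 3 ≤ n →
    (Elementary (+ 1) (cycle n) ⇔ ∃ λ k → 1 ≤ k × n ≡ 3 ℕ.* k)
theorem4p4 (suc zero) (s≤s ())
theorem4p4 (suc (suc zero)) (s≤s (s≤s ()))
theorem4p4 (suc (suc (suc m))) _ = mk⇔ to from
  where
  3+3j≡3[1+j] : ∀ j → 3 ℕ.+ j ℕ.* 3 ≡ 3 ℕ.* suc j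
  3+3j≡3[1+j] = ℕ-Solver.solve-∀
  to : Elementary (+ 1) (cycle (3 ℕ.+ m)) → ∃ λ k → 1 ≤ k × 3 ℕ.+ m ≡ 3 ℕ.* k
  to elementary = let j , m≡3j = elementary⇒3∣ m elementary in
    suc j , s≤s z≤n , trans (cong (3 ℕ.+_) m≡3j) (3+3j≡3[1+j] j)
  from : (∃ λ k → 1 ≤ k × 3 ℕ.+ m ≡ 3 ℕ.* k) → Elementary (+ 1) (cycle (3 ℕ.+ m))
  from (zero , () , _)
  from (suc j , _ , n≡3k) = subst (λ q → Elementary (+ 1) (cycle (3 ℕ.+ q))) (sym m≡3j) (cycle-elementary j)
    where
    m≡3j : m ≡ j ℕ.* 3
    m≡3j = ℕP.+-cancelˡ-≡ 3 m (j ℕ.* 3) (trans n≡3k (sym (3+3j≡3[1+j] j)))
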